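{- For every integer $n\geqslant 0$, the number $C(n)$ of partitions of $n$ with nonnegative crank is even unless $n$ is twice a generalized pentagonal number, i.e. unless $n=j(3j-1)$ for some $j\in\mathbb{Z}$.
   Context: For a partition $\lambda$, let $l(\lambda)$ be its largest part, $\omega(\lambda)$ the number of parts equal to $1$, and $\mu(\lambda)$ the number of parts greater than $\omega(\lambda)$. The crank is $c(\lambda)=l(\lambda)$ if $\omega(\lambda)=0$ and $c(\lambda)=\mu(\lambda)-\omega(\lambda)$ if $\omega(\lambda)>0$. $C(n)$ is the number of partitions $\lambda$ of $n$ with $c(\lambda)\geqslant 0$. Generalized pentagonal numbers are $j(3j-1)/2$, $j\in\mathbb{Z}$. -}

module Defs where

open import Data.Nat using (ℕ; zero; suc; _≥_; _<_; _≤_)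
open import Data.Nat.Properties using (_≟_; _<?_)
open import Data.Integer using (ℤ; +_; _-_)
open import Data.List using (List; []; _∷_; length; filter)
open import Data.Nat.ListAction using (sum)
open import Data.List.Relation.Unary.All using (All)
open import Data.List.Relation.Unary.Linked using (Linked)
open import Data.Product using (_×_)
open import Relation.Binary.PropositionalEquality using (_≡_)

IsPartition : ℕ → List ℕ → Set
IsPartition n λs = Linked _≥_ λs × All (1 ≤_) λs × sum λs ≡ n

largest : List ℕ → ℕ
largest []      = 0
largest (x ∷ _) = x

ω : List ℕ → ℕ
ω λs = length (filter (_≟ 1) λs)

μ : List ℕ → ℕ
μ λs = length (filter (ω λs <?_) λs)

crank : List ℕ → ℤ
crank λs with ω λs
... | zero  = + largest λs
... | suc k = + μ λs - + suc k

-- Let k be the largest index with λₖ > k. The k largest parts of λ are recorded by their gaps u ∈ ℕᵏ and the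
-- remaining parts, all at most k + 1, by their multiplicities folded into v ∈ ℕᵏ. This is a bijection onto such
-- pairs exactly when crank λ ≥ 0, and then |λ| = k (k + 1) + Σ i uᵢ + Σ i vᵢ. Swapping u and v is an involution
-- without fixed points off the diagonal u = v. On the diagonal |λ| = 2 |δ| for the strict partition δ with gaps u,
-- and Franklin's involution on δ takes over; its fixed points are the pentagonal shapes, where 2 |δ| = j (3j − 1).
-- So unless n has that form, the partitions of n with nonnegative crank are paired off and C(n) is even.

module Submission where

module FixedPointFreeInvolution {a} {A : Set a} where

  open import Data.Nat using (suc; _≤_; s≤s)
  open import Data.Nat.Properties using (≤-refl; ≤-trans; n≤1+n; +-suc)
  open import Data.Nat.Divisibility using (_∣_; divides)
  open import Data.List using (List; []; _∷_; _++_; length)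
  open import Data.List.Properties using (length-++)
  open import Data.List.Membership.Propositional using (_∈_; _∉_)
  open import Data.List.Membership.Propositional.Properties using (∈-∃++)
  open import Data.List.Relation.Unary.Any using (here; there)
  open import Data.List.Relation.Unary.All using (All; _∷_)
  open import Data.List.Relation.Unary.All.Properties using (All¬⇒¬Any)
  open import Data.List.Relation.Unary.AllPairs using (_∷_)
  open import Data.List.Relation.Unary.Unique.Propositional using (Unique)
  open import Data.Product using (_×_; _,_; proj₁)
  open import Data.Empty using (⊥-elim)
  open import Relation.Binary.PropositionalEquality using (_≡_; _≢_; refl; sym; trans; cong; subst)

  record IsFixedPointFreeInvolutionOn (f : A → A) (xs : List A) : Set a where
    field
      closed           : ∀ {x} → x ∈ xs → f x ∈ xs
      involutive       : ∀ {x} → x ∈ xs → f (f x) ≡ x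
      fixed-point-free : ∀ {x} → x ∈ xs → f x ≢ x

  private
    All-delete : ∀ {p} {P : A → Set p} (ys : List A) {v zs} → All P (ys ++ v ∷ zs) → All P (ys ++ zs) × P v
    All-delete []       (pv ∷ ps) = ps , pv
    All-delete (y ∷ ys) (py ∷ ps) with All-delete ys ps
    ... | ps′ , pv = py ∷ ps′ , pv

    Unique-delete : ∀ (ys : List A) {v zs} → Unique (ys ++ v ∷ zs) → Unique (ys ++ zs) × v ∉ ys ++ zs
    Unique-delete []       (v∉ ∷ u) = u , All¬⇒¬Any v∉
    Unique-delete (y ∷ ys) (y∉ ∷ u) with Unique-delete ys u | All-delete ys y∉
    ... | u′ , v∉ | y∉′ , y≢v = y∉′ ∷ u′ , λ { (here refl) → y≢v refl ; (there v∈) → v∉ v∈ }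

    ∈-delete : ∀ (ys : List A) {v y zs} → y ∈ ys ++ v ∷ zs → y ≢ v → y ∈ ys ++ zs
    ∈-delete []       (here refl) y≢v = ⊥-elim (y≢v refl)
    ∈-delete []       (there y∈)  _   = y∈
    ∈-delete (_ ∷ ys) (here refl) _   = here refl
    ∈-delete (_ ∷ ys) (there y∈)  y≢v = there (∈-delete ys y∈ y≢v)

    ∈-insert : ∀ (ys : List A) {v y zs} → y ∈ ys ++ zs → y ∈ ys ++ v ∷ zs
    ∈-insert []       y∈          = there y∈
    ∈-insert (_ ∷ ys) (here refl) = here refl
    ∈-insert (_ ∷ ys) (there y∈)  = there (∈-insert ys y∈)

    length-insert : ∀ ys {v : A} zs → length (ys ++ v ∷ zs) ≡ suc (length (ys ++ zs))
    length-insert ys zs = trans (length-++ ys) (trans (+-suc (length ys) (length zs)) (cong suc (sym (length-++ ys))))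

  restrict : ∀ {f x} (ys zs : List A) → Unique (x ∷ ys ++ f x ∷ zs) →
             IsFixedPointFreeInvolutionOn f (x ∷ ys ++ f x ∷ zs) → IsFixedPointFreeInvolutionOn f (ys ++ zs)
  restrict {f} {x} ys zs (x∉ ∷ u) inv = record
    { closed           = closed′
    ; involutive       = λ y∈ → involutive (keep y∈)
    ; fixed-point-free = λ y∈ → fixed-point-free (keep y∈)
    }
    where
    open IsFixedPointFreeInvolutionOn inv
    keep : ∀ {y} → y ∈ ys ++ zs → y ∈ x ∷ ys ++ f x ∷ zs
    keep y∈ = there (∈-insert ys y∈)
    y≢x : ∀ {y} → y ∈ ys ++ zs → y ≢ x
    y≢x y∈ refl = All¬⇒¬Any x∉ (∈-insert ys y∈)
    y≢fx : ∀ {y} → y ∈ ys ++ zs → y ≢ f x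
    y≢fx y∈ refl with Unique-delete ys u
    ... | _ , fx∉ = fx∉ y∈
    closed′ : ∀ {y} → y ∈ ys ++ zs → f y ∈ ys ++ zs
    closed′ {y} y∈ with closed (keep y∈)
    ... | here fy≡x   = ⊥-elim (y≢fx y∈ (trans (sym (involutive (keep y∈))) (cong f fy≡x)))
    ... | there fy∈ = ∈-delete ys fy∈ λ fy≡fx →
          y≢x y∈ (trans (sym (involutive (keep y∈))) (trans (cong f fy≡fx) (involutive (here refl))))

  even-length : ∀ {f} (xs : List A) → Unique xs → IsFixedPointFreeInvolutionOn f xs → 2 ∣ length xs
  even-length xs = go (length xs) xs ≤-refl
    where
    go : ∀ bound {f} (xs : List A) → length xs ≤ bound → Unique xs → IsFixedPointFreeInvolutionOn f xs →
         2 ∣ length xs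
    go _           []       _        _       _   = divides 0 refl
    go (suc bound) (x ∷ xs) (s≤s le) u@(_ ∷ u′) inv with IsFixedPointFreeInvolutionOn.closed inv (here refl)
    ... | here fx≡x = ⊥-elim (IsFixedPointFreeInvolutionOn.fixed-point-free inv (here refl) fx≡x)
    ... | there fx∈ with ∈-∃++ fx∈
    ... | ys , zs , refl with go bound (ys ++ zs) (≤-trans (n≤1+n _) (subst (_≤ bound) (length-insert ys zs) le))
                                 (proj₁ (Unique-delete ys u′)) (restrict ys zs u inv)
    ... | divides q eq = divides (suc q) (cong suc (trans (length-insert ys zs) (cong suc eq)))

module CrankInvolution where

  open import Defs
  open import Data.Nat using (ℕ; zero; suc; pred; _+_; _*_; _∸_; _≤_; _<_; _≥_; _>_; z≤n; s≤s; z<s; _/_; _%_)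
  open import Data.Nat.Properties
  open import Data.Nat.DivMod using (m≡m%n+[m/n]*n; m%n<n; [m+kn]%n≡m%n; m<n⇒m%n≡m)
  open import Data.Nat.ListAction using (sum)
  open import Data.Nat.ListAction.Properties using (sum-++)
  open import Data.Nat.Tactic.RingSolver using (solve-∀)
  open import Data.Integer as ℤ using (ℤ; +≤+)
  import Data.Integer.Properties as ℤP
  import Data.Integer.Tactic.RingSolver as ZR
  open import Data.List using (List; []; _∷_; _++_; length; [_]; filter; take; drop; replicate)
  open import Data.List.Properties
    using (≡-dec; length-++; length-take; length-replicate; filter-accept; filter-reject; filter-none; filter-all; filter-++;
           ++-assoc; ++-identityʳ; take++drop≡id)
  open import Data.List.Relation.Unary.All as All using (All; []; _∷_)
  open import Data.List.Relation.Unary.All.Properties using (++⁺; ++⁻ʳ; drop⁺; replicate⁺)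
  open import Data.List.Relation.Unary.Linked as Linked using (Linked; []; [-]; _∷_)
  open import Data.List.Relation.Unary.Linked.Properties using (Linked⇒All)
  open import Data.Product using (∃; _×_; _,_; proj₁; proj₂)
  open import Data.Sum using (_⊎_; inj₁; inj₂)
  open import Data.Empty using (⊥-elim)
  open import Function using (flip)
  open import Relation.Nullary using (¬_; Dec; yes; no; contradiction; ¬?; _×-dec_)
  open import Relation.Binary.PropositionalEquality hiding ([_])
  open ≡-Reasoning

  -- The crank condition

  NonIncreasing : List ℕ → Set
  NonIncreasing = Linked _≥_

  ≤-head : ∀ {x xs} → NonIncreasing (x ∷ xs) → All (_≤ x) (x ∷ xs)
  ≤-head = Linked⇒All (flip ≤-trans) ≤-refl

  mult : ℕ → List ℕ → ℕ
  mult j xs = length (filter (_≟ j) xs)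

  countAbove : ℕ → List ℕ → ℕ
  countAbove j xs = length (filter (j <?_) xs)

  -- depth i λ is the largest k with λ₁ > i, λ₂ > i + 1, …, λₖ > i + k − 1. Since λ is non-increasing, at least
  -- ω parts exceed ω iff λ_ω > ω, so crank λ ≥ 0 iff ω λ ≤ depth 1 λ.
  depth : ℕ → List ℕ → ℕ
  depth i []       = 0
  depth i (x ∷ xs) with i <? x
  ... | yes _ = suc (depth (suc i) xs)
  ... | no  _ = 0

  <-head : ∀ i k {x} xs → NonIncreasing (x ∷ xs) → i < x → k ≤ depth (suc i) xs → i + k < x
  <-head i zero    _        _         i<x _  = subst (_< _) (sym (+-identityʳ i)) i<x
  <-head i (suc k) {x} (y ∷ ys) (y≤x ∷ d) i<x k≤ with suc i <? y
  ... | yes i<y = subst (_< x) (sym (+-suc i k)) (<-≤-trans (<-head (suc i) k ys d i<y (≤-pred k≤)) y≤x)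
  <-head i (suc k) (y ∷ ys) _ _ () | no _

  countAbove-≡0 : ∀ {j xs} → All (_≤ j) xs → countAbove j xs ≡ 0
  countAbove-≡0 {j} xs≤j = cong length (filter-none (j <?_) (All.map ≤⇒≯ xs≤j))

  depth⇒countAbove : ∀ {i j} k xs → NonIncreasing xs → k ≤ depth i xs → j < i + k → k ≤ countAbove j xs
  depth⇒countAbove zero    _        _ _  _ = z≤n
  depth⇒countAbove {i} {j} (suc k) (x ∷ xs) d k≤ j< with i <? x
  ... | yes i<x = subst (suc k ≤_) (sym (cong length (filter-accept (j <?_) j<x)))
        (s≤s (depth⇒countAbove k xs (Linked.tail d) (≤-pred k≤) (subst (j <_) (+-suc i k) j<)))
    where
    j<x : j < x
    j<x = <-≤-trans j< (subst (_≤ x) (sym (+-suc i k)) (<-head i k xs d i<x (≤-pred k≤)))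
  depth⇒countAbove (suc k) (x ∷ xs) _ () _ | no _

  countAbove⇒depth : ∀ {i j} k xs → NonIncreasing xs → k ≤ countAbove j xs → i + k ≤ suc j → k ≤ depth i xs
  countAbove⇒depth zero    _        _ _  _ = z≤n
  countAbove⇒depth {i} {j} (suc k) (x ∷ xs) d k≤ i+k≤ with j <? x
  ... | no j≮x with () ← subst (suc k ≤_) (countAbove-≡0 (All.map (flip ≤-trans (≮⇒≥ j≮x)) (≤-head d))) k≤
  ... | yes j<x with i <? x
  ...   | yes _  = s≤s (countAbove⇒depth k xs (Linked.tail d) k≤′ i+1+k≤)
    where
    k≤′ : k ≤ countAbove j xs
    k≤′ = ≤-pred (subst (suc k ≤_) (cong length (filter-accept (j <?_) j<x)) k≤)
    i+1+k≤ : suc i + k ≤ suc j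
    i+1+k≤ = subst (_≤ suc j) (+-suc i k) i+k≤
  ...   | no i≮x = ⊥-elim (i≮x (≤-<-trans (m+n≤o⇒m≤o i (≤-pred (subst (_≤ suc j) (+-suc i k) i+k≤))) j<x))

  0≤crank⇒ω≤depth : ∀ {xs} → NonIncreasing xs → ℤ.+ 0 ℤ.≤ crank xs → ω xs ≤ depth 1 xs
  0≤crank⇒ω≤depth {xs} d 0≤crank with ω xs in ω≡
  ... | zero  = z≤n
  ... | suc k = countAbove⇒depth (suc k) xs d
                  (subst (λ w → suc k ≤ countAbove w xs) ω≡ (ℤP.drop‿+≤+ (ℤP.0≤i-j⇒j≤i 0≤crank))) ≤-refl

  ω≤depth⇒0≤crank : ∀ {xs} → NonIncreasing xs → ω xs ≤ depth 1 xs → ℤ.+ 0 ℤ.≤ crank xs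
  ω≤depth⇒0≤crank {xs} d ω≤depth with ω xs in ω≡
  ... | zero  = +≤+ z≤n
  ... | suc k = ℤP.i≤j⇒0≤j-i (+≤+ (subst (λ w → suc k ≤ countAbove w xs) (sym ω≡)
                  (depth⇒countAbove (suc k) xs d ω≤depth ≤-refl)))

  mult-++ : ∀ j xs ys → mult j (xs ++ ys) ≡ mult j xs + mult j ys
  mult-++ j xs ys = trans (cong length (filter-++ (_≟ j) xs ys)) (length-++ (filter (_≟ j) xs))

  mult-here : ∀ j xs → mult j (j ∷ xs) ≡ suc (mult j xs)
  mult-here j xs = cong length (filter-accept (_≟ j) refl)

  mult-there : ∀ {j x} xs → x ≢ j → mult j (x ∷ xs) ≡ mult j xs
  mult-there xs x≢j = cong length (filter-reject (_≟ _) x≢j)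

  mult-≡0 : ∀ j xs → All (_≢ j) xs → mult j xs ≡ 0
  mult-≡0 j xs xs≢j = cong length (filter-none (_≟ j) xs≢j)

  mult-replicate : ∀ j n → mult j (replicate n j) ≡ n
  mult-replicate j n = trans (cong length (filter-all (_≟ j) (replicate⁺ n refl))) (length-replicate n)

  mult-replicate-≢ : ∀ {i j} n → i ≢ j → mult j (replicate n i) ≡ 0
  mult-replicate-≢ n i≢j = mult-≡0 _ _ (replicate⁺ n i≢j)

  -- fromMults j (m₀, m₁, …) has m₀ parts j, m₁ parts j + 1, …; mults j m reads back m of these multiplicities.
  fromMults : ℕ → List ℕ → List ℕ
  fromMults j []       = []
  fromMults j (m ∷ ms) = fromMults (suc j) ms ++ replicate m j

  mults : ℕ → ℕ → List ℕ → List ℕ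
  mults j zero    xs = []
  mults j (suc m) xs = mult j xs ∷ mults (suc j) m xs

  length-mults : ∀ j m xs → length (mults j m xs) ≡ m
  length-mults j zero    xs = refl
  length-mults j (suc m) xs = cong suc (length-mults (suc j) m xs)

  mults-cong : ∀ j m xs ys → (∀ i → j ≤ i → i < j + m → mult i xs ≡ mult i ys) → mults j m xs ≡ mults j m ys
  mults-cong j zero    xs ys same = refl
  mults-cong j (suc m) xs ys same = cong₂ _∷_ (same j ≤-refl (m<m+n j z<s))
    (mults-cong (suc j) m xs ys λ i j<i i< → same i (<⇒≤ j<i) (subst (i <_) (sym (+-suc j m)) i<))

  fromMults-≥ : ∀ j ms → All (j ≤_) (fromMults j ms)
  fromMults-≥ j []       = []
  fromMults-≥ j (m ∷ ms) = ++⁺ (All.map <⇒≤ (fromMults-≥ (suc j) ms)) (replicate⁺ m ≤-refl)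

  fromMults-< : ∀ j ms → All (_< j + length ms) (fromMults j ms)
  fromMults-< j []       = []
  fromMults-< j (m ∷ ms) =
    ++⁺ (All.map (λ {x} → subst (x <_) (sym (+-suc j (length ms)))) (fromMults-< (suc j) ms)) (replicate⁺ m (m<m+n j z<s))

  mults-fromMults : ∀ j ms → mults j (length ms) (fromMults j ms) ≡ ms
  mults-fromMults j []       = refl
  mults-fromMults j (m ∷ ms) = cong₂ _∷_ head-mult tail-mults
    where
    head-mult : mult j (fromMults (suc j) ms ++ replicate m j) ≡ m
    head-mult = begin
      mult j (fromMults (suc j) ms ++ replicate m j)      ≡⟨ mult-++ j (fromMults (suc j) ms) _ ⟩
      mult j (fromMults (suc j) ms) + mult j (replicate m j)
        ≡⟨ cong₂ _+_ (mult-≡0 j _ (All.map >⇒≢ (fromMults-≥ (suc j) ms))) (mult-replicate j m) ⟩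
      m                                                    ∎
    same-above : ∀ i → suc j ≤ i → i < suc j + length ms →
                 mult i (fromMults (suc j) ms ++ replicate m j) ≡ mult i (fromMults (suc j) ms)
    same-above i j<i _ = begin
      mult i (fromMults (suc j) ms ++ replicate m j)     ≡⟨ mult-++ i (fromMults (suc j) ms) _ ⟩
      mult i (fromMults (suc j) ms) + mult i (replicate m j)
        ≡⟨ cong (mult i (fromMults (suc j) ms) +_) (mult-replicate-≢ m (<⇒≢ j<i)) ⟩
      mult i (fromMults (suc j) ms) + 0                   ≡⟨ +-identityʳ _ ⟩
      mult i (fromMults (suc j) ms)                       ∎
    tail-mults : mults (suc j) (length ms) (fromMults (suc j) ms ++ replicate m j) ≡ ms
    tail-mults = trans (mults-cong (suc j) (length ms) _ _ same-above) (mults-fromMults (suc j) ms)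

  fromMults-mults-suc : ∀ j m xs →
    fromMults j (mults j (suc m) xs) ≡ replicate (mult (j + m) xs) (j + m) ++ fromMults j (mults j m xs)
  fromMults-mults-suc j zero xs = begin
    replicate (mult j xs) j             ≡⟨ cong (λ i → replicate (mult i xs) i) (sym (+-identityʳ j)) ⟩
    replicate (mult (j + 0) xs) (j + 0) ≡⟨ sym (++-identityʳ _) ⟩
    replicate (mult (j + 0) xs) (j + 0) ++ [] ∎
  fromMults-mults-suc j (suc m) xs = begin
    fromMults (suc j) (mults (suc j) (suc m) xs) ++ replicate (mult j xs) j
      ≡⟨ cong (_++ replicate (mult j xs) j) (fromMults-mults-suc (suc j) m xs) ⟩
    (replicate (mult (suc j + m) xs) (suc j + m) ++ fromMults (suc j) (mults (suc j) m xs)) ++ replicate (mult j xs) j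
      ≡⟨ ++-assoc (replicate (mult (suc j + m) xs) (suc j + m)) _ _ ⟩
    replicate (mult (suc j + m) xs) (suc j + m) ++ fromMults j (mults j (suc m) xs)
      ≡⟨ cong (λ i → replicate (mult i xs) i ++ fromMults j (mults j (suc m) xs)) (sym (+-suc j m)) ⟩
    replicate (mult (j + suc m) xs) (j + suc m) ++ fromMults j (mults j (suc m) xs) ∎

  fromMults-mults-top : ∀ m xs →
    fromMults 1 (mults 1 (suc m) (suc m ∷ xs)) ≡ suc m ∷ fromMults 1 (mults 1 (suc m) xs)
  fromMults-mults-top m xs = begin
    fromMults 1 (mults 1 (suc m) (suc m ∷ xs))
      ≡⟨ fromMults-mults-suc 1 m (suc m ∷ xs) ⟩
    replicate (mult (suc m) (suc m ∷ xs)) (suc m) ++ fromMults 1 (mults 1 m (suc m ∷ xs))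
      ≡⟨ cong₂ (λ k ms → replicate k (suc m) ++ fromMults 1 ms) (mult-here (suc m) xs)
               (mults-cong 1 m _ _ λ i _ i<1+m → mult-there xs (>⇒≢ i<1+m)) ⟩
    suc m ∷ replicate (mult (suc m) xs) (suc m) ++ fromMults 1 (mults 1 m xs)
      ≡⟨ cong (suc m ∷_) (sym (fromMults-mults-suc 1 m xs)) ⟩
    suc m ∷ fromMults 1 (mults 1 (suc m) xs) ∎

  fromMults-mults-below : ∀ m xs → All (_≤ m) xs → fromMults 1 (mults 1 (suc m) xs) ≡ fromMults 1 (mults 1 m xs)
  fromMults-mults-below m xs xs≤m = begin
    fromMults 1 (mults 1 (suc m) xs)                                  ≡⟨ fromMults-mults-suc 1 m xs ⟩
    replicate (mult (suc m) xs) (suc m) ++ fromMults 1 (mults 1 m xs)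
      ≡⟨ cong (λ k → replicate k (suc m) ++ fromMults 1 (mults 1 m xs))
              (mult-≡0 (suc m) xs (All.map (λ y≤m → <⇒≢ (s≤s y≤m)) xs≤m)) ⟩
    fromMults 1 (mults 1 m xs)                                         ∎

  fromMults-mults-cons : ∀ m {x} xs → 1 ≤ x → x ≤ m → All (_≤ x) xs →
    fromMults 1 (mults 1 m (x ∷ xs)) ≡ x ∷ fromMults 1 (mults 1 m xs)
  fromMults-mults-cons zero    xs 1≤x x≤0 _ with () ← ≤-trans 1≤x x≤0
  fromMults-mults-cons (suc m) {x} xs 1≤x x≤1+m xs≤x with x ≟ suc m
  ... | yes refl  = fromMults-mults-top m xs
  ... | no x≢1+m = begin
    fromMults 1 (mults 1 (suc m) (x ∷ xs))  ≡⟨ fromMults-mults-below m (x ∷ xs) (x≤m ∷ xs≤m) ⟩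
    fromMults 1 (mults 1 m (x ∷ xs))        ≡⟨ fromMults-mults-cons m xs 1≤x x≤m xs≤x ⟩
    x ∷ fromMults 1 (mults 1 m xs)          ≡⟨ cong (x ∷_) (sym (fromMults-mults-below m xs xs≤m)) ⟩
    x ∷ fromMults 1 (mults 1 (suc m) xs)    ∎
    where
    x≤m : x ≤ m
    x≤m = ≤-pred (≤∧≢⇒< x≤1+m x≢1+m)
    xs≤m : All (_≤ m) xs
    xs≤m = All.map (λ y≤x → ≤-trans y≤x x≤m) xs≤x

  fromMults-mults-[] : ∀ m → fromMults 1 (mults 1 m []) ≡ []
  fromMults-mults-[] zero    = refl
  fromMults-mults-[] (suc m) = trans (fromMults-mults-below m [] []) (fromMults-mults-[] m)

  fromMults-mults : ∀ m xs → NonIncreasing xs → All (1 ≤_) xs → All (_≤ m) xs → fromMults 1 (mults 1 m xs) ≡ xs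
  fromMults-mults m []       _ _           _             = fromMults-mults-[] m
  fromMults-mults m (x ∷ xs) d (1≤x ∷ pos) (x≤m ∷ xs≤m) =
    trans (fromMults-mults-cons m xs 1≤x x≤m (All.tail (≤-head d)))
          (cong (x ∷_) (fromMults-mults m xs (Linked.tail d) pos xs≤m))

  -- weight (u₁, …, uₖ) = 1·u₁ + 2·u₂ + … + k·uₖ
  weight : List ℕ → ℕ
  weight []       = 0
  weight (u ∷ us) = u + sum us + weight us

  partsFromGaps : ℕ → List ℕ → List ℕ
  partsFromGaps c []       = []
  partsFromGaps c (u ∷ us) = (u + sum us + c) ∷ partsFromGaps c us

  gaps : ℕ → List ℕ → List ℕ
  gaps c []           = []
  gaps c (x ∷ [])     = (x ∸ c) ∷ []
  gaps c (x ∷ y ∷ xs) = (x ∸ y) ∷ gaps c (y ∷ xs)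

  length-partsFromGaps : ∀ c us → length (partsFromGaps c us) ≡ length us
  length-partsFromGaps c []       = refl
  length-partsFromGaps c (u ∷ us) = cong suc (length-partsFromGaps c us)

  length-gaps : ∀ c xs → length (gaps c xs) ≡ length xs
  length-gaps c []           = refl
  length-gaps c (x ∷ [])     = refl
  length-gaps c (x ∷ y ∷ xs) = cong suc (length-gaps c (y ∷ xs))

  sum-partsFromGaps : ∀ c us → sum (partsFromGaps c us) ≡ length us * c + weight us
  sum-partsFromGaps c []       = refl
  sum-partsFromGaps c (u ∷ us) =
    trans (cong ((u + sum us + c) +_) (sum-partsFromGaps c us)) (rearrange u (sum us) c (length us) (weight us))
    where
    rearrange : ∀ u s c l w → (u + s + c) + (l * c + w) ≡ suc l * c + (u + s + w)
    rearrange = solve-∀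

  partsFromGaps-≥ : ∀ c us → All (c ≤_) (partsFromGaps c us)
  partsFromGaps-≥ c []       = []
  partsFromGaps-≥ c (u ∷ us) = m≤n+m c (u + sum us) ∷ partsFromGaps-≥ c us

  NonIncreasing-partsFromGaps : ∀ c us → NonIncreasing (partsFromGaps c us)
  NonIncreasing-partsFromGaps c []           = []
  NonIncreasing-partsFromGaps c (u ∷ [])     = [-]
  NonIncreasing-partsFromGaps c (u ∷ v ∷ us) =
    +-monoˡ-≤ c (m≤n+m (v + sum us) u) ∷ NonIncreasing-partsFromGaps c (v ∷ us)

  gaps-partsFromGaps : ∀ c us → gaps c (partsFromGaps c us) ≡ us
  gaps-partsFromGaps c []           = refl
  gaps-partsFromGaps c (u ∷ [])     = cong (_∷ []) (trans (cong (λ x → x + c ∸ c) (+-identityʳ u)) (m+n∸n≡m u c))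
  gaps-partsFromGaps c (u ∷ v ∷ us) = cong₂ _∷_
    (trans (cong (_∸ (v + sum us + c)) (+-assoc u (v + sum us) c)) (m+n∸n≡m u (v + sum us + c)))
    (gaps-partsFromGaps c (v ∷ us))

  sum-gaps : ∀ c x xs → NonIncreasing (x ∷ xs) → All (c ≤_) (x ∷ xs) → sum (gaps c (x ∷ xs)) + c ≡ x
  sum-gaps c x []       _           (c≤x ∷ _)   = trans (cong (_+ c) (+-identityʳ (x ∸ c))) (m∸n+n≡m c≤x)
  sum-gaps c x (y ∷ xs) (y≤x ∷ d) (_ ∷ c≤ys) = begin
    (x ∸ y) + sum (gaps c (y ∷ xs)) + c   ≡⟨ +-assoc (x ∸ y) _ c ⟩
    (x ∸ y) + (sum (gaps c (y ∷ xs)) + c) ≡⟨ cong ((x ∸ y) +_) (sum-gaps c y xs d c≤ys) ⟩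
    (x ∸ y) + y                           ≡⟨ m∸n+n≡m y≤x ⟩
    x                                     ∎

  partsFromGaps-gaps : ∀ c xs → NonIncreasing xs → All (c ≤_) xs → partsFromGaps c (gaps c xs) ≡ xs
  partsFromGaps-gaps c []           _ _           = refl
  partsFromGaps-gaps c (x ∷ [])     d c≤          = cong (_∷ []) (sum-gaps c x [] d c≤)
  partsFromGaps-gaps c (x ∷ y ∷ xs) d (c≤x ∷ c≤ys) =
    cong₂ _∷_ (sum-gaps c x (y ∷ xs) d (c≤x ∷ c≤ys)) (partsFromGaps-gaps c (y ∷ xs) (Linked.tail d) c≤ys)

  NonIncreasing-++ : ∀ {c} xs ys → NonIncreasing xs → NonIncreasing ys → All (c ≤_) xs → All (_≤ c) ys →
                     NonIncreasing (xs ++ ys)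
  NonIncreasing-++ []           ys       _         dys _           _           = dys
  NonIncreasing-++ (x ∷ [])     []       _         _   _           _           = [-]
  NonIncreasing-++ (x ∷ [])     (y ∷ ys) _         dys (c≤x ∷ _)   (y≤c ∷ _)   = ≤-trans y≤c c≤x ∷ dys
  NonIncreasing-++ (x ∷ x′ ∷ xs) ys      (x′≤x ∷ d) dys (_ ∷ c≤xs) ys≤c =
    x′≤x ∷ NonIncreasing-++ (x′ ∷ xs) ys d dys c≤xs ys≤c

  NonIncreasing-replicate : ∀ n x → NonIncreasing (replicate n x)
  NonIncreasing-replicate zero          x = []
  NonIncreasing-replicate (suc zero)    x = [-]
  NonIncreasing-replicate (suc (suc n)) x = ≤-refl ∷ NonIncreasing-replicate (suc n) x

  NonIncreasing-take : ∀ n xs → NonIncreasing xs → NonIncreasing (take n xs)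
  NonIncreasing-take zero          xs           _       = []
  NonIncreasing-take (suc n)       []           _       = []
  NonIncreasing-take (suc zero)    (x ∷ xs)     _       = [-]
  NonIncreasing-take (suc (suc n)) (x ∷ [])     _       = [-]
  NonIncreasing-take (suc (suc n)) (x ∷ y ∷ xs) (y≤x ∷ d) = y≤x ∷ NonIncreasing-take (suc n) (y ∷ xs) d

  NonIncreasing-drop : ∀ n xs → NonIncreasing xs → NonIncreasing (drop n xs)
  NonIncreasing-drop zero    xs       d = d
  NonIncreasing-drop (suc n) []       _ = []
  NonIncreasing-drop (suc n) (x ∷ xs) d = NonIncreasing-drop n xs (Linked.tail d)

  NonIncreasing-fromMults : ∀ j ms → NonIncreasing (fromMults j ms)
  NonIncreasing-fromMults j []       = []
  NonIncreasing-fromMults j (m ∷ ms) =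
    NonIncreasing-++ (fromMults (suc j) ms) (replicate m j) (NonIncreasing-fromMults (suc j) ms) (NonIncreasing-replicate m j)
      (All.map <⇒≤ (fromMults-≥ (suc j) ms)) (replicate⁺ m ≤-refl)

  sum-replicate : ∀ n x → sum (replicate n x) ≡ n * x
  sum-replicate zero    x = refl
  sum-replicate (suc n) x = cong (x +_) (sum-replicate n x)

  sum-fromMults : ∀ j ms → sum (fromMults (suc j) ms) ≡ j * sum ms + weight ms
  sum-fromMults j []       = sym (cong (_+ 0) (*-zeroʳ j))
  sum-fromMults j (m ∷ ms) = begin
    sum (fromMults (suc (suc j)) ms ++ replicate m (suc j))
      ≡⟨ sum-++ (fromMults (suc (suc j)) ms) (replicate m (suc j)) ⟩
    sum (fromMults (suc (suc j)) ms) + sum (replicate m (suc j))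
      ≡⟨ cong₂ _+_ (sum-fromMults (suc j) ms) (sum-replicate m (suc j)) ⟩
    (suc j * sum ms + weight ms) + m * suc j
      ≡⟨ rearrange j (sum ms) (weight ms) m ⟩
    j * (m + sum ms) + (m + sum ms + weight ms) ∎
    where
    rearrange : ∀ j s w m → (suc j * s + w) + m * suc j ≡ j * (m + s) + (m + s + w)
    rearrange = solve-∀

  -- The parts ≤ t + 1 with multiplicities m₁, …, m_{t+1}, encoded as (m₁ + (t + 1)·m_{t+1}, m₂, …, m_t).
  smallParts : ℕ → List ℕ → List ℕ
  smallParts t []       = []
  smallParts t (v ∷ vs) = replicate (v / suc t) (suc t) ++ fromMults 2 vs ++ replicate (v % suc t) 1

  smallVector : ℕ → List ℕ → List ℕ
  smallVector zero    xs = []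
  smallVector (suc t) xs = (mult 1 xs + mult (suc (suc t)) xs * suc (suc t)) ∷ mults 2 t xs

  length-smallVector : ∀ t xs → length (smallVector t xs) ≡ t
  length-smallVector zero    xs = refl
  length-smallVector (suc t) xs = cong suc (length-mults 2 t xs)

  smallParts-positive : ∀ t v vs → All (1 ≤_) (smallParts t (v ∷ vs))
  smallParts-positive t v vs =
    ++⁺ (replicate⁺ (v / suc t) (s≤s z≤n))
        (++⁺ (All.map (≤-trans (s≤s z≤n)) (fromMults-≥ 2 vs)) (replicate⁺ (v % suc t) ≤-refl))

  smallParts-≤ : ∀ t v vs → length vs ≤ t → All (_≤ suc t) (smallParts t (v ∷ vs))
  smallParts-≤ t v vs vs≤t =
    ++⁺ (replicate⁺ (v / suc t) ≤-refl)
        (++⁺ (All.map (λ x<2+l → ≤-trans (≤-pred x<2+l) (s≤s vs≤t)) (fromMults-< 2 vs)) (replicate⁺ (v % suc t) (s≤s z≤n)))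

  NonIncreasing-smallParts : ∀ t v vs → length vs ≤ t → NonIncreasing (smallParts t (v ∷ vs))
  NonIncreasing-smallParts t v vs vs≤t =
    NonIncreasing-++ (replicate (v / suc t) (suc t)) _ (NonIncreasing-replicate _ _) nonIncreasing-rest
      (replicate⁺ _ ≤-refl) (++⁻ʳ (replicate (v / suc t) (suc t)) (smallParts-≤ t v vs vs≤t))
    where
    nonIncreasing-rest : NonIncreasing (fromMults 2 vs ++ replicate (v % suc t) 1)
    nonIncreasing-rest = NonIncreasing-++ (fromMults 2 vs) _ (NonIncreasing-fromMults 2 vs) (NonIncreasing-replicate _ _)
      (All.map (≤-trans (s≤s z≤n)) (fromMults-≥ 2 vs)) (replicate⁺ _ ≤-refl)

  sum-smallParts : ∀ t vs → sum (smallParts t vs) ≡ weight vs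
  sum-smallParts t []       = refl
  sum-smallParts t (v ∷ vs) = begin
    sum (replicate q n ++ fromMults 2 vs ++ replicate r 1)
      ≡⟨ sum-++ (replicate q n) _ ⟩
    sum (replicate q n) + sum (fromMults 2 vs ++ replicate r 1)
      ≡⟨ cong (sum (replicate q n) +_) (sum-++ (fromMults 2 vs) _) ⟩
    sum (replicate q n) + (sum (fromMults 2 vs) + sum (replicate r 1))
      ≡⟨ cong₂ (λ a b → a + (b + sum (replicate r 1))) (sum-replicate q n) (sum-fromMults 1 vs) ⟩
    q * n + ((1 * sum vs + weight vs) + sum (replicate r 1))
      ≡⟨ cong (λ b → q * n + ((1 * sum vs + weight vs) + b)) (sum-replicate r 1) ⟩
    q * n + ((1 * sum vs + weight vs) + r * 1)
      ≡⟨ rearrange q n (sum vs) (weight vs) r ⟩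
    r + q * n + sum vs + weight vs
      ≡⟨ cong (λ a → a + sum vs + weight vs) (sym (m≡m%n+[m/n]*n v n)) ⟩
    v + sum vs + weight vs ∎
    where
    n = suc t
    q = v / n
    r = v % n
    rearrange : ∀ q n s w r → q * n + ((1 * s + w) + r * 1) ≡ r + q * n + s + w
    rearrange = solve-∀

  mult1-smallParts : ∀ t v vs → mult 1 (smallParts (suc t) (v ∷ vs)) ≡ v % suc (suc t)
  mult1-smallParts t v vs = begin
    mult 1 (replicate (v / n) n ++ fromMults 2 vs ++ replicate (v % n) 1)
      ≡⟨ mult-++ 1 (replicate (v / n) n) _ ⟩
    mult 1 (replicate (v / n) n) + mult 1 (fromMults 2 vs ++ replicate (v % n) 1)
      ≡⟨ cong₂ _+_ (mult-replicate-≢ (v / n) λ ()) (mult-++ 1 (fromMults 2 vs) _) ⟩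
    mult 1 (fromMults 2 vs) + mult 1 (replicate (v % n) 1)
      ≡⟨ cong₂ _+_ (mult-≡0 1 _ (All.map >⇒≢ (fromMults-≥ 2 vs))) (mult-replicate 1 (v % n)) ⟩
    v % n ∎
    where n = suc (suc t)

  multTop-smallParts : ∀ t v vs → length vs ≤ t → mult (suc (suc t)) (smallParts (suc t) (v ∷ vs)) ≡ v / suc (suc t)
  multTop-smallParts t v vs vs≤t = begin
    mult n (replicate (v / n) n ++ fromMults 2 vs ++ replicate (v % n) 1)
      ≡⟨ mult-++ n (replicate (v / n) n) _ ⟩
    mult n (replicate (v / n) n) + mult n (fromMults 2 vs ++ replicate (v % n) 1)
      ≡⟨ cong₂ _+_ (mult-replicate n (v / n)) (mult-++ n (fromMults 2 vs) _) ⟩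
    v / n + (mult n (fromMults 2 vs) + mult n (replicate (v % n) 1))
      ≡⟨ cong (v / n +_) (cong₂ _+_ (mult-≡0 n _ (All.map below (fromMults-< 2 vs))) (mult-replicate-≢ (v % n) λ ())) ⟩
    v / n + 0
      ≡⟨ +-identityʳ _ ⟩
    v / n ∎
    where
    n = suc (suc t)
    below : ∀ {x} → x < 2 + length vs → x ≢ n
    below x< = <⇒≢ (≤-trans x< (s≤s (s≤s vs≤t)))

  multMid-smallParts : ∀ t v vs i → 2 ≤ i → i < 2 + t → mult i (smallParts (suc t) (v ∷ vs)) ≡ mult i (fromMults 2 vs)
  multMid-smallParts t v vs i 2≤i i<n = begin
    mult i (replicate (v / n) n ++ fromMults 2 vs ++ replicate (v % n) 1)
      ≡⟨ mult-++ i (replicate (v / n) n) _ ⟩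
    mult i (replicate (v / n) n) + mult i (fromMults 2 vs ++ replicate (v % n) 1)
      ≡⟨ cong₂ _+_ (mult-replicate-≢ (v / n) (>⇒≢ i<n)) (mult-++ i (fromMults 2 vs) _) ⟩
    mult i (fromMults 2 vs) + mult i (replicate (v % n) 1)
      ≡⟨ cong (mult i (fromMults 2 vs) +_) (mult-replicate-≢ (v % n) (<⇒≢ 2≤i)) ⟩
    mult i (fromMults 2 vs) + 0
      ≡⟨ +-identityʳ _ ⟩
    mult i (fromMults 2 vs) ∎
    where n = suc (suc t)

  smallVector-smallParts : ∀ t v vs → length vs ≡ t → smallVector (suc t) (smallParts (suc t) (v ∷ vs)) ≡ v ∷ vs
  smallVector-smallParts t v vs refl = cong₂ _∷_ first rest
    where
    n = suc (suc t)
    xs = smallParts (suc t) (v ∷ vs)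
    first : mult 1 xs + mult n xs * n ≡ v
    first = trans (cong₂ (λ r q → r + q * n) (mult1-smallParts t v vs) (multTop-smallParts t v vs ≤-refl))
                  (sym (m≡m%n+[m/n]*n v n))
    rest : mults 2 t xs ≡ vs
    rest = trans (mults-cong 2 t xs (fromMults 2 vs) (multMid-smallParts t v vs)) (mults-fromMults 2 vs)

  smallParts-smallVector : ∀ t xs → NonIncreasing xs → All (1 ≤_) xs → All (_≤ suc (suc t)) xs → mult 1 xs ≤ suc t →
                           smallParts (suc t) (smallVector (suc t) xs) ≡ xs
  smallParts-smallVector t xs d pos xs≤ ones≤ = begin
    replicate (v / n) n ++ fromMults 2 (mults 2 t xs) ++ replicate (v % n) 1
      ≡⟨ cong₂ (λ q r → replicate q n ++ fromMults 2 (mults 2 t xs) ++ replicate r 1) quotient remainder ⟩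
    replicate (mult n xs) n ++ fromMults 2 (mults 2 t xs) ++ replicate (mult 1 xs) 1
      ≡⟨ sym (++-assoc (replicate (mult n xs) n) _ _) ⟩
    (replicate (mult n xs) n ++ fromMults 2 (mults 2 t xs)) ++ replicate (mult 1 xs) 1
      ≡⟨ cong (_++ replicate (mult 1 xs) 1) (sym (fromMults-mults-suc 2 t xs)) ⟩
    fromMults 1 (mults 1 n xs)
      ≡⟨ fromMults-mults n xs d pos xs≤ ⟩
    xs ∎
    where
    n = suc (suc t)
    v = mult 1 xs + mult n xs * n
    remainder : v % n ≡ mult 1 xs
    remainder = trans ([m+kn]%n≡m%n (mult 1 xs) (mult n xs) n) (m<n⇒m%n≡m (s≤s ones≤))
    quotient : v / n ≡ mult n xs
    quotient = *-cancelʳ-≡ (v / n) (mult n xs) n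
      (+-cancelˡ-≡ (mult 1 xs) _ _ (trans (cong (_+ v / n * n) (sym remainder)) (sym (m≡m%n+[m/n]*n v n))))

  take-length-++ : ∀ (xs ys : List ℕ) → take (length xs) (xs ++ ys) ≡ xs
  take-length-++ []       ys = refl
  take-length-++ (x ∷ xs) ys = cong (x ∷_) (take-length-++ xs ys)

  drop-length-++ : ∀ (xs ys : List ℕ) → drop (length xs) (xs ++ ys) ≡ ys
  drop-length-++ []       ys = refl
  drop-length-++ (x ∷ xs) ys = drop-length-++ xs ys

  depth≤length : ∀ i xs → depth i xs ≤ length xs
  depth≤length i []       = z≤n
  depth≤length i (x ∷ xs) with i <? x
  ... | yes _ = s≤s (depth≤length (suc i) xs)
  ... | no  _ = z≤n

  depth-≡0 : ∀ i xs → All (_≤ i) xs → depth i xs ≡ 0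
  depth-≡0 i []       _           = refl
  depth-≡0 i (x ∷ xs) (x≤i ∷ _) with i <? x
  ... | yes i<x = ⊥-elim (<⇒≱ i<x x≤i)
  ... | no  _   = refl

  depth-partsFromGaps-++ : ∀ i c us ys → i + length us ≤ c →
                           depth i (partsFromGaps c us ++ ys) ≡ length us + depth (i + length us) ys
  depth-partsFromGaps-++ i c []       ys _ = cong (λ j → depth j ys) (sym (+-identityʳ i))
  depth-partsFromGaps-++ i c (u ∷ us) ys i+l≤c with i <? (u + sum us + c)
  ... | yes _ = cong suc (trans (depth-partsFromGaps-++ (suc i) c us ys (subst (_≤ c) (+-suc i (length us)) i+l≤c))
                                (cong (λ j → length us + depth j ys) (sym (+-suc i (length us)))))
  ... | no i≮ = ⊥-elim (i≮ (<-≤-trans i<c (m≤n+m c (u + sum us))))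
    where
    i<c : i < c
    i<c = ≤-trans (s≤s (m≤m+n i (length us))) (subst (_≤ c) (+-suc i (length us)) i+l≤c)

  take-depth-≥ : ∀ k i xs → k ≤ depth i xs → NonIncreasing xs → All (i + k ≤_) (take k xs)
  take-depth-≥ zero    i xs       _  _ = []
  take-depth-≥ (suc k) i (x ∷ xs) k≤ d with i <? x
  ... | yes i<x = subst (_≤ x) (sym (+-suc i k)) (<-head i k xs d i<x (≤-pred k≤))
                  ∷ All.map (λ {y} → subst (_≤ y) (sym (+-suc i k)))
                            (take-depth-≥ k (suc i) xs (≤-pred k≤) (Linked.tail d))
  take-depth-≥ (suc k) i (x ∷ xs) () _ | no _

  drop-depth-≤ : ∀ i xs → NonIncreasing xs → All (_≤ i + depth i xs) (drop (depth i xs) xs)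
  drop-depth-≤ i []       _ = []
  drop-depth-≤ i (x ∷ xs) d with i <? x
  ... | yes _  = All.map (λ {y} → subst (y ≤_) (sym (+-suc i (depth (suc i) xs)))) (drop-depth-≤ (suc i) xs (Linked.tail d))
  ... | no i≮x = All.map (λ {y} y≤x → subst (y ≤_) (sym (+-identityʳ i)) (≤-trans y≤x (≮⇒≥ i≮x)))
                         (≤-head d)

  depth0⇒[] : ∀ xs → All (1 ≤_) xs → depth 1 xs ≡ 0 → ω xs ≡ 0 → xs ≡ []
  depth0⇒[] []       _           _      _  = refl
  depth0⇒[] (x ∷ xs) (1≤x ∷ _) depth≡ ω≡ with 1 <? x
  ... | no 1≮x with refl ← ≤-antisym (≮⇒≥ 1≮x) 1≤x with () ← trans (sym (mult-here 1 xs)) ω≡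

  -- Encoding partitions of nonnegative crank

  NonnegCrankPartition : ℕ → List ℕ → Set
  NonnegCrankPartition n xs = IsPartition n xs × ℤ.+ 0 ℤ.≤ crank xs

  -- The last of the k = depth 1 λ gaps is taken against k + 1, and smallVector loses nothing on the remaining
  -- parts because crank λ ≥ 0 means ω λ ≤ k.
  decode : List ℕ × List ℕ → List ℕ
  decode (u , v) = partsFromGaps (suc (length u)) u ++ smallParts (length u) v

  encodeAt : ℕ → List ℕ → List ℕ × List ℕ
  encodeAt k xs = gaps (suc k) (take k xs) , smallVector k (drop k xs)

  encode : List ℕ → List ℕ × List ℕ
  encode xs = encodeAt (depth 1 xs) xs

  ValidCode : ℕ → List ℕ × List ℕ → Set
  ValidCode n (u , v) = length v ≡ length u × sum (decode (u , v)) ≡ n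

  sum-decode : ∀ u v → sum (decode (u , v)) ≡ length u * suc (length u) + weight u + weight v
  sum-decode u v = trans (sum-++ (partsFromGaps (suc (length u)) u) _)
    (cong₂ _+_ (sum-partsFromGaps (suc (length u)) u) (sum-smallParts (length u) v))

  depth-decode : ∀ u vs v → length vs ≤ length u → depth 1 (decode (u , v ∷ vs)) ≡ length u
  depth-decode u vs v vs≤u = begin
    depth 1 (partsFromGaps (suc k) u ++ smallParts k (v ∷ vs))  ≡⟨ depth-partsFromGaps-++ 1 (suc k) u _ ≤-refl ⟩
    k + depth (suc k) (smallParts k (v ∷ vs))                    ≡⟨ cong (k +_) (depth-≡0 (suc k) _ (smallParts-≤ k v vs vs≤u)) ⟩
    k + 0                                                        ≡⟨ +-identityʳ k ⟩
    k                                                            ∎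
    where k = length u

  encode-decode : ∀ u v → length v ≡ length u → encode (decode (u , v)) ≡ (u , v)
  encode-decode []       []       _  = refl
  encode-decode (u ∷ us) (v ∷ vs) l≡ =
    trans (cong (λ k → encodeAt k (big ++ small)) (depth-decode (u ∷ us) vs v vs≤k)) (cong₂ _,_ gaps-part small-part)
    where
    k = suc (length us)
    big = partsFromGaps (suc k) (u ∷ us)
    small = smallParts k (v ∷ vs)
    vs≤k : length vs ≤ k
    vs≤k = ≤-trans (≤-reflexive (suc-injective l≡)) (n≤1+n _)
    |big|≡k : length big ≡ k
    |big|≡k = length-partsFromGaps (suc k) (u ∷ us)
    gaps-part : gaps (suc k) (take k (big ++ small)) ≡ u ∷ us
    gaps-part = begin
      gaps (suc k) (take k (big ++ small))                   ≡⟨ cong (λ l → gaps (suc k) (take l (big ++ small))) (sym |big|≡k) ⟩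
      gaps (suc k) (take (length big) (big ++ small))        ≡⟨ cong (gaps (suc k)) (take-length-++ big small) ⟩
      gaps (suc k) big                                       ≡⟨ gaps-partsFromGaps (suc k) (u ∷ us) ⟩
      u ∷ us                                                 ∎
    small-part : smallVector k (drop k (big ++ small)) ≡ v ∷ vs
    small-part = begin
      smallVector k (drop k (big ++ small))                  ≡⟨ cong (λ l → smallVector k (drop l (big ++ small))) (sym |big|≡k) ⟩
      smallVector k (drop (length big) (big ++ small))       ≡⟨ cong (smallVector k) (drop-length-++ big small) ⟩
      smallVector k small                                    ≡⟨ smallVector-smallParts (length us) v vs (suc-injective l≡) ⟩
      v ∷ vs                                                 ∎

  decode-valid : ∀ {n} u v → ValidCode n (u , v) → NonnegCrankPartition n (decode (u , v))
  decode-valid []       []       (_ , sum≡) = ([] , [] , sum≡) , ω≤depth⇒0≤crank [] z≤n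
  decode-valid (u ∷ us) (v ∷ vs) (l≡ , sum≡) =
    (nonIncreasing , positive , sum≡) , ω≤depth⇒0≤crank nonIncreasing ω≤depth
    where
    k = suc (length us)
    vs≤k : length vs ≤ k
    vs≤k = ≤-trans (≤-reflexive (suc-injective l≡)) (n≤1+n _)
    big = partsFromGaps (suc k) (u ∷ us)
    small = smallParts k (v ∷ vs)
    nonIncreasing : NonIncreasing (big ++ small)
    nonIncreasing = NonIncreasing-++ big small (NonIncreasing-partsFromGaps (suc k) (u ∷ us))
      (NonIncreasing-smallParts k v vs vs≤k) (partsFromGaps-≥ (suc k) (u ∷ us)) (smallParts-≤ k v vs vs≤k)
    positive : All (1 ≤_) (big ++ small)
    positive = ++⁺ (All.map (≤-trans (s≤s z≤n)) (partsFromGaps-≥ (suc k) (u ∷ us))) (smallParts-positive k v vs)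
    ones : ω (big ++ small) ≡ v % suc k
    ones = begin
      mult 1 (big ++ small)      ≡⟨ mult-++ 1 big small ⟩
      mult 1 big + mult 1 small  ≡⟨ cong₂ _+_ (mult-≡0 1 big (All.map (λ 2+k≤x → >⇒≢ (≤-trans (s≤s (s≤s z≤n)) 2+k≤x))
                                                                   (partsFromGaps-≥ (suc k) (u ∷ us))))
                                             (mult1-smallParts (length us) v vs) ⟩
      v % suc k                  ∎
    ω≤depth : ω (big ++ small) ≤ depth 1 (big ++ small)
    ω≤depth = subst₂ _≤_ (sym ones) (sym (depth-decode (u ∷ us) vs v vs≤k)) (≤-pred (m%n<n v (suc k)))

  length-gaps-take : ∀ k xs → k ≤ length xs → length (gaps (suc k) (take k xs)) ≡ k
  length-gaps-take k xs k≤ = trans (length-gaps (suc k) (take k xs)) (trans (length-take k xs) (m≤n⇒m⊓n≡m k≤))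

  decode-encodeAt : ∀ k xs → depth 1 xs ≡ k → NonIncreasing xs → All (1 ≤_) xs → ω xs ≤ k → decode (encodeAt k xs) ≡ xs
  decode-encodeAt k xs depth≡ d pos ω≤k = begin
    partsFromGaps (suc l) (gaps (suc k) (take k xs)) ++ smallParts l (smallVector k (drop k xs))
      ≡⟨ cong (λ l → partsFromGaps (suc l) (gaps (suc k) (take k xs)) ++ smallParts l (smallVector k (drop k xs))) l≡k ⟩
    partsFromGaps (suc k) (gaps (suc k) (take k xs)) ++ smallParts k (smallVector k (drop k xs))
      ≡⟨ cong₂ _++_ (partsFromGaps-gaps (suc k) (take k xs) (NonIncreasing-take k xs d) (take-depth-≥ k 1 xs k≤depth d))
                    (smallParts-smallVector-drop k depth≡ ω≤k) ⟩
    take k xs ++ drop k xs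
      ≡⟨ take++drop≡id k xs ⟩
    xs ∎
    where
    l = length (gaps (suc k) (take k xs))
    k≤depth : k ≤ depth 1 xs
    k≤depth = ≤-reflexive (sym depth≡)
    l≡k : l ≡ k
    l≡k = length-gaps-take k xs (≤-trans k≤depth (depth≤length 1 xs))
    smallParts-smallVector-drop : ∀ k → depth 1 xs ≡ k → ω xs ≤ k → smallParts k (smallVector k (drop k xs)) ≡ drop k xs
    smallParts-smallVector-drop zero    depth≡0 ω≤0 = sym (depth0⇒[] xs pos depth≡0 (n≤0⇒n≡0 ω≤0))
    smallParts-smallVector-drop (suc t) depth≡ ω≤ = smallParts-smallVector t (drop (suc t) xs)
      (NonIncreasing-drop (suc t) xs d) (drop⁺ (suc t) pos)
      (subst (λ k → All (_≤ suc k) (drop k xs)) depth≡ (drop-depth-≤ 1 xs d))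
      (≤-trans (subst (mult 1 (drop (suc t) xs) ≤_) ones-split (m≤n+m _ _)) ω≤)
      where
      ones-split : mult 1 (take (suc t) xs) + mult 1 (drop (suc t) xs) ≡ ω xs
      ones-split = trans (sym (mult-++ 1 (take (suc t) xs) _)) (cong (mult 1) (take++drop≡id (suc t) xs))

  decode-encode : ∀ {n xs} → NonnegCrankPartition n xs → decode (encode xs) ≡ xs
  decode-encode {xs = xs} ((d , pos , _) , 0≤crank) =
    decode-encodeAt (depth 1 xs) xs refl d pos (0≤crank⇒ω≤depth d 0≤crank)

  encode-valid : ∀ {n xs} → NonnegCrankPartition n xs → ValidCode n (encode xs)
  encode-valid {xs = xs} p@((_ , _ , sum≡) , _) = lengths , trans (cong sum (decode-encode p)) sum≡
    where
    k = depth 1 xs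
    lengths : length (smallVector k (drop k xs)) ≡ length (gaps (suc k) (take k xs))
    lengths = trans (length-smallVector k _) (sym (length-gaps-take k xs (depth≤length 1 xs)))

  -- Franklin's involution

  Strict : List ℕ → Set
  Strict δ = Linked _>_ δ × All (1 ≤_) δ

  -- The length of the longest run δ₁, δ₁ − 1, δ₁ − 2, … at the start of δ.
  slope : List ℕ → ℕ
  slope []           = 0
  slope (x ∷ [])     = 1
  slope (x ∷ y ∷ xs) = extendRun (x ≟ suc y) (slope (y ∷ xs))
    where
    -- a helper rather than `with`, which would hide that the recursive call is structural
    extendRun : Dec (x ≡ suc y) → ℕ → ℕ
    extendRun (yes _) n = suc n
    extendRun (no  _) _ = 1

  smallest : List ℕ → ℕ
  smallest []           = 0
  smallest (x ∷ [])     = x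
  smallest (x ∷ y ∷ xs) = smallest (y ∷ xs)

  dropLast : List ℕ → List ℕ
  dropLast []           = []
  dropLast (x ∷ [])     = []
  dropLast (x ∷ y ∷ xs) = x ∷ dropLast (y ∷ xs)

  incrementFirst : ℕ → List ℕ → List ℕ
  incrementFirst zero    xs       = xs
  incrementFirst (suc s) []       = []
  incrementFirst (suc s) (x ∷ xs) = suc x ∷ incrementFirst s xs

  decrementFirst : ℕ → List ℕ → List ℕ
  decrementFirst zero    xs       = xs
  decrementFirst (suc s) []       = []
  decrementFirst (suc s) (x ∷ xs) = pred x ∷ decrementFirst s xs

  spreadSmallest : List ℕ → List ℕ
  spreadSmallest δ = incrementFirst (smallest δ) (dropLast δ)

  gatherSlope : List ℕ → List ℕ
  gatherSlope δ = decrementFirst (slope δ) δ ++ [ slope δ ]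

  SpreadCase : List ℕ → Set
  SpreadCase δ = smallest δ ≤ slope δ × smallest δ < length δ

  GatherCase : List ℕ → Set
  GatherCase δ = slope δ < smallest δ × ¬ (slope δ ≡ length δ × smallest δ ≡ suc (slope δ))

  spreadCase? : ∀ δ → Dec (SpreadCase δ)
  spreadCase? δ = (smallest δ ≤? slope δ) ×-dec (smallest δ <? length δ)

  gatherCase? : ∀ δ → Dec (GatherCase δ)
  gatherCase? δ = (slope δ <? smallest δ) ×-dec ¬? ((slope δ ≟ length δ) ×-dec (smallest δ ≟ suc (slope δ)))

  -- Move the smallest part onto the first parts, or the slope off them into a new smallest part; each undoes
  -- the other and changes the number of parts by one.
  franklin : List ℕ → List ℕ
  franklin δ with spreadCase? δ | gatherCase? δ
  ... | yes _ | _     = spreadSmallest δ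
  ... | no  _ | yes _ = gatherSlope δ
  ... | no  _ | no  _ = δ

  smallest-snoc : ∀ xs y → smallest (xs ++ [ y ]) ≡ y
  smallest-snoc []           y = refl
  smallest-snoc (x ∷ [])     y = refl
  smallest-snoc (x ∷ x′ ∷ xs) y = smallest-snoc (x′ ∷ xs) y

  dropLast-snoc : ∀ xs y → dropLast (xs ++ [ y ]) ≡ xs
  dropLast-snoc []           y = refl
  dropLast-snoc (x ∷ [])     y = refl
  dropLast-snoc (x ∷ x′ ∷ xs) y = cong (x ∷_) (dropLast-snoc (x′ ∷ xs) y)

  dropLast++smallest : ∀ x xs → dropLast (x ∷ xs) ++ [ smallest (x ∷ xs) ] ≡ x ∷ xs
  dropLast++smallest x []       = refl
  dropLast++smallest x (y ∷ xs) = cong (x ∷_) (dropLast++smallest y xs)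

  length-dropLast : ∀ x xs → length (dropLast (x ∷ xs)) ≡ length xs
  length-dropLast x []       = refl
  length-dropLast x (y ∷ xs) = cong suc (length-dropLast y xs)

  sum-dropLast : ∀ x xs → sum (dropLast (x ∷ xs)) + smallest (x ∷ xs) ≡ sum (x ∷ xs)
  sum-dropLast x []       = sym (+-identityʳ x)
  sum-dropLast x (y ∷ xs) = trans (+-assoc x _ _) (cong (x +_) (sum-dropLast y xs))

  Linked-dropLast : ∀ {R : ℕ → ℕ → Set} xs → Linked R xs → Linked R (dropLast xs)
  Linked-dropLast []               _       = []
  Linked-dropLast (x ∷ [])         _       = []
  Linked-dropLast (x ∷ y ∷ [])     _       = [-]
  Linked-dropLast (x ∷ y ∷ z ∷ xs) (r ∷ l) = r ∷ Linked-dropLast (y ∷ z ∷ xs) l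

  All-dropLast : ∀ {P : ℕ → Set} xs → All P xs → All P (dropLast xs)
  All-dropLast []           _        = []
  All-dropLast (x ∷ [])     _        = []
  All-dropLast (x ∷ y ∷ xs) (p ∷ ps) = p ∷ All-dropLast (y ∷ xs) ps

  All-smallest : ∀ {P : ℕ → Set} x xs → All P (x ∷ xs) → P (smallest (x ∷ xs))
  All-smallest x []       (p ∷ _)  = p
  All-smallest x (y ∷ xs) (_ ∷ ps) = All-smallest y xs ps

  smallest-≤-all : ∀ xs → Linked _>_ xs → All (smallest xs ≤_) xs
  smallest-≤-all []           _         = []
  smallest-≤-all (x ∷ [])     _         = ≤-refl ∷ []
  smallest-≤-all (x ∷ y ∷ xs) (y<x ∷ l) with smallest-≤-all (y ∷ xs) l
  ... | s≤y ∷ s≤ys = ≤-trans s≤y (<⇒≤ y<x) ∷ s≤y ∷ s≤ys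

  smallest<smallest-dropLast : ∀ x y xs → Linked _>_ (x ∷ y ∷ xs) → smallest (x ∷ y ∷ xs) < smallest (dropLast (x ∷ y ∷ xs))
  smallest<smallest-dropLast x y []       (y<x ∷ _) = y<x
  smallest<smallest-dropLast x y (z ∷ xs) (_ ∷ l)   = smallest<smallest-dropLast y z xs l

  Strict-snoc : ∀ xs y → Linked _>_ xs → (xs ≡ [] ⊎ y < smallest xs) → Linked _>_ (xs ++ [ y ])
  Strict-snoc []            y _         _         = [-]
  Strict-snoc (x ∷ [])      y _         (inj₂ y<x) = y<x ∷ [-]
  Strict-snoc (x ∷ x′ ∷ xs) y (x′<x ∷ l) (inj₂ y<) = x′<x ∷ Strict-snoc (x′ ∷ xs) y l (inj₂ y<)

  length-incrementFirst : ∀ s xs → length (incrementFirst s xs) ≡ length xs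
  length-incrementFirst zero    xs       = refl
  length-incrementFirst (suc s) []       = refl
  length-incrementFirst (suc s) (x ∷ xs) = cong suc (length-incrementFirst s xs)

  length-decrementFirst : ∀ s xs → length (decrementFirst s xs) ≡ length xs
  length-decrementFirst zero    xs       = refl
  length-decrementFirst (suc s) []       = refl
  length-decrementFirst (suc s) (x ∷ xs) = cong suc (length-decrementFirst s xs)

  decrementFirst-incrementFirst : ∀ s xs → decrementFirst s (incrementFirst s xs) ≡ xs
  decrementFirst-incrementFirst zero    xs       = refl
  decrementFirst-incrementFirst (suc s) []       = refl
  decrementFirst-incrementFirst (suc s) (x ∷ xs) = cong (x ∷_) (decrementFirst-incrementFirst s xs)

  incrementFirst-decrementFirst : ∀ s xs → All (1 ≤_) xs → incrementFirst s (decrementFirst s xs) ≡ xs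
  incrementFirst-decrementFirst zero    xs           _        = refl
  incrementFirst-decrementFirst (suc s) []           _        = refl
  incrementFirst-decrementFirst (suc s) (suc x ∷ xs) (_ ∷ ps) = cong (suc x ∷_) (incrementFirst-decrementFirst s xs ps)

  sum-incrementFirst : ∀ s xs → s ≤ length xs → sum (incrementFirst s xs) ≡ s + sum xs
  sum-incrementFirst zero    xs       _        = refl
  sum-incrementFirst (suc s) (x ∷ xs) (s≤s s≤l) =
    cong suc (trans (cong (x +_) (sum-incrementFirst s xs s≤l)) (+-swapˡ x s (sum xs)))
    where
    +-swapˡ : ∀ a b c → a + (b + c) ≡ b + (a + c)
    +-swapˡ = solve-∀

  sum-decrementFirst : ∀ s xs → s ≤ length xs → All (1 ≤_) xs → sum (decrementFirst s xs) + s ≡ sum xs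
  sum-decrementFirst zero    xs           _         _        = +-identityʳ _
  sum-decrementFirst (suc s) (suc x ∷ xs) (s≤s s≤l) (_ ∷ ps) =
    trans (+-suc (x + sum (decrementFirst s xs)) s)
          (cong suc (trans (+-assoc x _ s) (cong (x +_) (sum-decrementFirst s xs s≤l ps))))

  positive-incrementFirst : ∀ s xs → All (1 ≤_) xs → All (1 ≤_) (incrementFirst s xs)
  positive-incrementFirst zero    xs       ps       = ps
  positive-incrementFirst (suc s) []       _        = []
  positive-incrementFirst (suc s) (x ∷ xs) (_ ∷ ps) = s≤s z≤n ∷ positive-incrementFirst s xs ps

  positive-decrementFirst : ∀ s xs → All (2 ≤_) xs → All (1 ≤_) (decrementFirst s xs)
  positive-decrementFirst zero    xs           ps             = All.map (≤-trans (s≤s z≤n)) ps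
  positive-decrementFirst (suc s) []           _              = []
  positive-decrementFirst (suc s) (suc x ∷ xs) (s≤s 1≤x ∷ ps) = 1≤x ∷ positive-decrementFirst s xs ps

  Strict-incrementFirst : ∀ s xs → Linked _>_ xs → Linked _>_ (incrementFirst s xs)
  Strict-incrementFirst zero          xs           l         = l
  Strict-incrementFirst (suc s)       []           _         = []
  Strict-incrementFirst (suc zero)    (x ∷ [])     _         = [-]
  Strict-incrementFirst (suc zero)    (x ∷ y ∷ xs) (y<x ∷ l) = ≤-trans y<x (n≤1+n x) ∷ l
  Strict-incrementFirst (suc (suc s)) (x ∷ [])     _         = [-]
  Strict-incrementFirst (suc (suc s)) (x ∷ y ∷ xs) (y<x ∷ l) = s≤s y<x ∷ Strict-incrementFirst (suc s) (y ∷ xs) l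

  smallest-incrementFirst-≥ : ∀ s xs → smallest xs ≤ smallest (incrementFirst s xs)
  smallest-incrementFirst-≥ zero          xs           = ≤-refl
  smallest-incrementFirst-≥ (suc s)       []           = ≤-refl
  smallest-incrementFirst-≥ (suc zero)    (x ∷ [])     = n≤1+n x
  smallest-incrementFirst-≥ (suc zero)    (x ∷ y ∷ xs) = ≤-refl
  smallest-incrementFirst-≥ (suc (suc s)) (x ∷ [])     = n≤1+n x
  smallest-incrementFirst-≥ (suc (suc s)) (x ∷ y ∷ xs) = smallest-incrementFirst-≥ (suc s) (y ∷ xs)

  smallest-incrementFirst-all : ∀ s x xs → length (x ∷ xs) ≤ s → smallest (incrementFirst s (x ∷ xs)) ≡ suc (smallest (x ∷ xs))
  smallest-incrementFirst-all (suc zero)    x []       _         = refl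
  smallest-incrementFirst-all (suc zero)    x (_ ∷ _)  (s≤s ())
  smallest-incrementFirst-all (suc (suc s)) x []       _         = refl
  smallest-incrementFirst-all (suc (suc s)) x (y ∷ xs) (s≤s l≤s) = smallest-incrementFirst-all (suc s) y xs l≤s

  smallest-decrementFirst-part : ∀ s xs → s < length xs → smallest (decrementFirst s xs) ≡ smallest xs
  smallest-decrementFirst-part zero          xs           _         = refl
  smallest-decrementFirst-part (suc zero)    (x ∷ [])     (s≤s ())
  smallest-decrementFirst-part (suc zero)    (x ∷ y ∷ xs) _         = refl
  smallest-decrementFirst-part (suc (suc s)) (x ∷ y ∷ xs) (s≤s s<l) = smallest-decrementFirst-part (suc s) (y ∷ xs) s<l

  smallest-decrementFirst-all : ∀ s x xs → length (x ∷ xs) ≤ s → smallest (decrementFirst s (x ∷ xs)) ≡ pred (smallest (x ∷ xs))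
  smallest-decrementFirst-all (suc zero)    x []       _         = refl
  smallest-decrementFirst-all (suc zero)    x (_ ∷ _)  (s≤s ())
  smallest-decrementFirst-all (suc (suc s)) x []       _         = refl
  smallest-decrementFirst-all (suc (suc s)) x (y ∷ xs) (s≤s l≤s) = smallest-decrementFirst-all (suc s) y xs l≤s

  slope-step : ∀ x y xs → x ≡ suc y → slope (x ∷ y ∷ xs) ≡ suc (slope (y ∷ xs))
  slope-step x y xs x≡1+y with x ≟ suc y
  ... | yes _    = refl
  ... | no x≢1+y = contradiction x≡1+y x≢1+y

  slope-break : ∀ x y xs → x ≢ suc y → slope (x ∷ y ∷ xs) ≡ 1
  slope-break x y xs x≢1+y with x ≟ suc y
  ... | yes x≡1+y = contradiction x≡1+y x≢1+y
  ... | no _      = refl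

  slope-positive : ∀ x xs → 1 ≤ slope (x ∷ xs)
  slope-positive x []       = ≤-refl
  slope-positive x (y ∷ xs) with x ≟ suc y
  ... | yes _ = s≤s z≤n
  ... | no  _ = ≤-refl

  slope≤length : ∀ xs → slope xs ≤ length xs
  slope≤length []       = z≤n
  slope≤length (x ∷ xs) = slope-∷≤ x xs
    where
    slope-∷≤ : ∀ x xs → slope (x ∷ xs) ≤ suc (length xs)
    slope-∷≤ x []       = ≤-refl
    slope-∷≤ x (y ∷ xs) with x ≟ suc y
    ... | yes _ = s≤s (slope-∷≤ y xs)
    ... | no  _ = s≤s z≤n

  slope-++ : ∀ k x xs ys → k ≤ slope (x ∷ xs ++ ys) → k ≤ suc (length xs) → k ≤ slope (x ∷ xs)
  slope-++ zero          x xs       ys _  _          = z≤n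
  slope-++ (suc zero)    x xs       ys _  _          = slope-positive x xs
  slope-++ (suc (suc k)) x (y ∷ xs) ys k≤ (s≤s k≤l) with x ≟ suc y
  ... | yes _ = s≤s (slope-++ (suc k) y xs ys (≤-pred k≤) k≤l)
  slope-++ (suc (suc k)) x (y ∷ xs) ys (s≤s ()) _ | no _

  slope-incrementFirst : ∀ s x xs → Linked _>_ (x ∷ xs) → 1 ≤ s → s ≤ slope (x ∷ xs) → s ≤ suc (length xs) →
                         slope (incrementFirst s (x ∷ xs)) ≡ s
  slope-incrementFirst (suc zero)    x []       _         _ _  _          = refl
  slope-incrementFirst (suc zero)    x (y ∷ xs) (y<x ∷ _) _ _  _          =
    slope-break (suc x) y xs (λ 1+x≡1+y → <-irrefl (sym (suc-injective 1+x≡1+y)) y<x)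
  slope-incrementFirst (suc (suc s)) x (y ∷ xs) (_ ∷ l)   _ s≤ (s≤s s≤l) with x ≟ suc y
  ... | yes x≡1+y = trans (slope-step (suc x) (suc y) (incrementFirst s xs) (cong suc x≡1+y))
                          (cong suc (slope-incrementFirst (suc s) y xs l (s≤s z≤n) (≤-pred s≤) s≤l))
  slope-incrementFirst (suc (suc s)) x (y ∷ xs) _ _ (s≤s ()) _ | no _

  slope-decrementFirst : ∀ k x xs ys → All (1 ≤_) (x ∷ xs) → k ≤ slope (x ∷ xs) → k ≤ slope (decrementFirst k (x ∷ xs) ++ ys)
  slope-decrementFirst zero          x xs           ys _                 _  = z≤n
  slope-decrementFirst (suc zero)    x xs           ys _                 _  = slope-positive (pred x) (xs ++ ys)
  slope-decrementFirst (suc (suc k)) x (suc y ∷ xs) ys (_ ∷ pos) k≤ with x ≟ suc (suc y)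
  ... | yes refl = subst (suc (suc k) ≤_) (sym (slope-step (suc y) y (decrementFirst k xs ++ ys) refl))
                         (s≤s (slope-decrementFirst (suc k) (suc y) xs ys pos (≤-pred k≤)))
  slope-decrementFirst (suc (suc k)) x (suc y ∷ xs) ys _ (s≤s ()) | no _
  slope-decrementFirst (suc (suc k)) x []           ys _           (s≤s ())
  slope-decrementFirst (suc (suc k)) x (zero ∷ xs)  ys (_ ∷ () ∷ _) _

  pred-> : ∀ x y → y < x → x ≢ suc y → y < pred x
  pred-> (suc x) y (s≤s y≤x) x≢1+y = ≤∧≢⇒< y≤x (λ y≡x → x≢1+y (cong suc (sym y≡x)))

  Strict-decrementFirst : ∀ k x xs → Linked _>_ (x ∷ xs) → All (1 ≤_) (x ∷ xs) → slope (x ∷ xs) ≡ k →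
                          Linked _>_ (decrementFirst k (x ∷ xs))
  Strict-decrementFirst zero          x xs               l           _           _       = l
  Strict-decrementFirst (suc zero)    x []               _           _           _       = [-]
  Strict-decrementFirst (suc (suc k)) x []               _           _           _       = [-]
  Strict-decrementFirst (suc zero)    x (suc y ∷ xs)     (1+y<x ∷ l) (_ ∷ pos) slope≡1 with x ≟ suc (suc y)
  ... | no x≢2+y = pred-> x (suc y) 1+y<x x≢2+y ∷ l
  ... | yes _ with () ← subst (1 ≤_) (suc-injective slope≡1) (slope-positive (suc y) xs)
  Strict-decrementFirst (suc (suc k)) x (suc y ∷ xs) (_ ∷ l) (_ ∷ pos) slope≡ with x ≟ suc (suc y)
  ... | yes refl = ≤-refl ∷ Strict-decrementFirst (suc k) (suc y) xs l pos (suc-injective slope≡)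
  Strict-decrementFirst (suc (suc k)) x (suc y ∷ xs) _ _ () | no _
  Strict-decrementFirst (suc k)       x (zero ∷ xs)  _ (_ ∷ () ∷ _) _

  length-gatherSlope : ∀ δ → length (gatherSlope δ) ≡ suc (length δ)
  length-gatherSlope δ =
    trans (length-++ (decrementFirst (slope δ) δ)) (trans (+-comm _ 1) (cong suc (length-decrementFirst (slope δ) δ)))

  record SpreadFacts (δ : List ℕ) : Set where
    field
      strict  : Strict (spreadSmallest δ)
      gather  : GatherCase (spreadSmallest δ)
      inverse : gatherSlope (spreadSmallest δ) ≡ δ
      sum≡    : sum (spreadSmallest δ) ≡ sum δ
      shorter : length (spreadSmallest δ) < length δ

  record GatherFacts (δ : List ℕ) : Set where
    field
      strict  : Strict (gatherSlope δ)
      spread  : SpreadCase (gatherSlope δ)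
      inverse : spreadSmallest (gatherSlope δ) ≡ δ
      sum≡    : sum (gatherSlope δ) ≡ sum δ

  spread-facts : ∀ δ → Strict δ → SpreadCase δ → SpreadFacts δ
  spread-facts (x ∷ [])     (_ , 1≤x ∷ []) (_ , s≤s x≤0) with () ← ≤-trans 1≤x x≤0
  spread-facts (x ∷ y ∷ xs) (l , pos) (s≤σ , s<t) = record
    { strict  = Strict-incrementFirst s P (Linked-dropLast δ l) , positive-incrementFirst s P (All-dropLast δ pos)
    ; gather  = subst (_< smallest P′) (sym slope′≡s) s<smallest′ , not-exceptional
    ; inverse = begin
        decrementFirst (slope P′) P′ ++ [ slope P′ ] ≡⟨ cong (λ k → decrementFirst k P′ ++ [ k ]) slope′≡s ⟩
        decrementFirst s P′ ++ [ s ]                  ≡⟨ cong (_++ [ s ]) (decrementFirst-incrementFirst s P) ⟩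
        P ++ [ s ]                                    ≡⟨ dropLast++smallest x (y ∷ xs) ⟩
        δ                                             ∎
    ; sum≡    = trans (sum-incrementFirst s P s≤|P|) (trans (+-comm s (sum P)) (sum-dropLast x (y ∷ xs)))
    ; shorter = subst (_< length δ) (sym (trans (length-incrementFirst s P) |P|≡)) ≤-refl
    }
    where
    δ = x ∷ y ∷ xs
    s = smallest δ
    P = dropLast δ
    P′ = incrementFirst s P
    |P|≡ : length P ≡ suc (length xs)
    |P|≡ = length-dropLast x (y ∷ xs)
    s≤|P| : s ≤ length P
    s≤|P| = subst (s ≤_) (sym |P|≡) (≤-pred s<t)
    s≤slopeP : s ≤ slope P
    s≤slopeP = slope-++ s x (dropLast (y ∷ xs)) [ s ]
                 (subst (λ ys → s ≤ slope ys) (sym (dropLast++smallest x (y ∷ xs))) s≤σ) s≤|P|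
    slope′≡s : slope P′ ≡ s
    slope′≡s = slope-incrementFirst s x (dropLast (y ∷ xs)) (Linked-dropLast δ l) (All-smallest x (y ∷ xs) pos)
                 s≤slopeP s≤|P|
    s<smallestP : s < smallest P
    s<smallestP = smallest<smallest-dropLast x y xs l
    s<smallest′ : s < smallest P′
    s<smallest′ = ≤-trans s<smallestP (smallest-incrementFirst-≥ s P)
    not-exceptional : ¬ (slope P′ ≡ length P′ × smallest P′ ≡ suc (slope P′))
    not-exceptional (slope≡length , smallest≡) = <-irrefl refl (subst (s <_) (suc-injective 1+smallest≡1+s) s<smallestP)
      where
      s≡|P| : s ≡ length P
      s≡|P| = trans (sym slope′≡s) (trans slope≡length (length-incrementFirst s P))
      1+smallest≡1+s : suc (smallest P) ≡ suc s
      1+smallest≡1+s = trans (sym (smallest-incrementFirst-all s x (dropLast (y ∷ xs)) (≤-reflexive (sym s≡|P|))))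
                             (trans smallest≡ (cong suc slope′≡s))

  gather-facts : ∀ δ → Strict δ → GatherCase δ → GatherFacts δ
  gather-facts (x ∷ xs) (l , pos) (σ<s , not-exceptional) = record
    { strict  = Strict-snoc D σ (Strict-decrementFirst σ x xs l pos refl) (inj₂ σ<smallestD)
              , ++⁺ (positive-decrementFirst σ δ all≥2) (1≤σ ∷ [])
    ; spread  = subst (_≤ slope (D ++ [ σ ])) (sym (smallest-snoc D σ)) (slope-decrementFirst σ x xs [ σ ] pos ≤-refl)
              , subst₂ _<_ (sym (smallest-snoc D σ)) (sym (length-gatherSlope δ)) (s≤s σ≤t)
    ; inverse = trans (cong₂ incrementFirst (smallest-snoc D σ) (dropLast-snoc D σ)) (incrementFirst-decrementFirst σ δ pos)
    ; sum≡    = trans (sum-++ D [ σ ]) (trans (cong (sum D +_) (+-identityʳ σ)) (sum-decrementFirst σ δ σ≤t pos))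
    }
    where
    δ = x ∷ xs
    σ = slope δ
    D = decrementFirst σ δ
    σ≤t : σ ≤ length δ
    σ≤t = slope≤length δ
    1≤σ : 1 ≤ σ
    1≤σ = slope-positive x xs
    all≥2 : All (2 ≤_) δ
    all≥2 = All.map (λ s≤y → ≤-trans (s≤s 1≤σ) (≤-trans σ<s s≤y)) (smallest-≤-all δ l)
    -- When the run covers all of δ its last part is decremented too; the excluded shape s = σ + 1 is exactly
    -- the one where that would make it collide with the new part σ.
    σ<smallestD : σ < smallest D
    σ<smallestD with σ <? length δ
    ... | yes σ<t = subst (σ <_) (sym (smallest-decrementFirst-part σ δ σ<t)) σ<s
    ... | no σ≮t = subst (σ <_) (sym (smallest-decrementFirst-all σ x xs (≮⇒≥ σ≮t)))
                         (pred-> (smallest δ) σ σ<s (λ s≡1+σ → not-exceptional (≤-antisym σ≤t (≮⇒≥ σ≮t) , s≡1+σ)))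

  franklin-spread : ∀ δ → SpreadCase δ → franklin δ ≡ spreadSmallest δ
  franklin-spread δ spread with spreadCase? δ
  ... | yes _       = refl
  ... | no ¬spread = contradiction spread ¬spread

  franklin-gather : ∀ δ → GatherCase δ → franklin δ ≡ gatherSlope δ
  franklin-gather δ gather with spreadCase? δ | gatherCase? δ
  ... | yes (s≤σ , _) | _           = contradiction (proj₁ gather) (≤⇒≯ s≤σ)
  ... | no _          | yes _       = refl
  ... | no _          | no ¬gather = contradiction gather ¬gather

  franklin-id : ∀ δ → ¬ SpreadCase δ → ¬ GatherCase δ → franklin δ ≡ δ
  franklin-id δ ¬spread ¬gather with spreadCase? δ | gatherCase? δ
  ... | yes spread | _          = contradiction spread ¬spread
  ... | no _       | yes gather = contradiction gather ¬gather
  ... | no _       | no _       = refl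

  franklin-strict : ∀ δ → Strict δ → Strict (franklin δ)
  franklin-strict δ sδ with spreadCase? δ | gatherCase? δ
  ... | yes spread | _          = SpreadFacts.strict (spread-facts δ sδ spread)
  ... | no _       | yes gather = GatherFacts.strict (gather-facts δ sδ gather)
  ... | no _       | no _       = sδ

  franklin-sum : ∀ δ → Strict δ → sum (franklin δ) ≡ sum δ
  franklin-sum δ sδ with spreadCase? δ | gatherCase? δ
  ... | yes spread | _          = SpreadFacts.sum≡ (spread-facts δ sδ spread)
  ... | no _       | yes gather = GatherFacts.sum≡ (gather-facts δ sδ gather)
  ... | no _       | no _       = refl

  franklin-involutive : ∀ δ → Strict δ → franklin (franklin δ) ≡ δ
  franklin-involutive δ sδ with spreadCase? δ | gatherCase? δ
  ... | yes spread | _ = trans (franklin-gather (spreadSmallest δ) gather) inverse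
    where open SpreadFacts (spread-facts δ sδ spread)
  ... | no _ | yes gather = trans (franklin-spread (gatherSlope δ) spread) inverse
    where open GatherFacts (gather-facts δ sδ gather)
  ... | no ¬spread | no ¬gather = franklin-id δ ¬spread ¬gather

  franklin-fixed : ∀ δ → Strict δ → franklin δ ≡ δ → ¬ SpreadCase δ × ¬ GatherCase δ
  franklin-fixed δ sδ fixed =
    (λ spread → <-irrefl (cong length (trans (sym (franklin-spread δ spread)) fixed))
                         (SpreadFacts.shorter (spread-facts δ sδ spread))) ,
    (λ gather → <-irrefl (cong length (trans (sym fixed) (franklin-gather δ gather)))
                         (subst (length δ <_) (sym (length-gatherSlope δ)) ≤-refl))

  franklin-fixed-shape : ∀ δ → ¬ SpreadCase δ → ¬ GatherCase δ →
                         slope δ ≡ length δ × (smallest δ ≡ length δ ⊎ smallest δ ≡ suc (length δ))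
  franklin-fixed-shape δ ¬spread ¬gather with slope δ <? smallest δ
  ... | yes σ<s with (slope δ ≟ length δ) ×-dec (smallest δ ≟ suc (slope δ))
  ...   | yes (σ≡t , s≡1+σ) = σ≡t , inj₂ (trans s≡1+σ (cong suc σ≡t))
  ...   | no not-exceptional = contradiction (σ<s , not-exceptional) ¬gather
  franklin-fixed-shape δ ¬spread ¬gather | no σ≮s = σ≡t , inj₁ (≤-antisym (≤-trans s≤σ σ≤t) t≤s)
    where
    s≤σ : smallest δ ≤ slope δ
    s≤σ = ≮⇒≥ σ≮s
    t≤s : length δ ≤ smallest δ
    t≤s = ≮⇒≥ (λ s<t → ¬spread (s≤σ , s<t))
    σ≤t : slope δ ≤ length δ
    σ≤t = slope≤length δ
    σ≡t : slope δ ≡ length δ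
    σ≡t = ≤-antisym σ≤t (≤-trans t≤s s≤σ)

  consecutive-sum : ∀ x xs → slope (x ∷ xs) ≡ suc (length xs) →
    suc x ≡ smallest (x ∷ xs) + suc (length xs) ×
    2 * sum (x ∷ xs) + suc (length xs) ≡ suc (length xs) * (2 * smallest (x ∷ xs) + suc (length xs))
  consecutive-sum x []       _       = +-comm 1 x , base x
    where
    base : ∀ x → 2 * (x + 0) + 1 ≡ 1 * (2 * x + 1)
    base = solve-∀
  consecutive-sum x (y ∷ xs) slope≡ with x ≟ suc y
  ... | yes x≡1+y = head≡ , sum≡
    where
    s = smallest (y ∷ xs)
    t = suc (length xs)
    ih = consecutive-sum y xs (suc-injective slope≡)
    x≡s+t : x ≡ s + t
    x≡s+t = trans x≡1+y (proj₁ ih)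
    head≡ : suc x ≡ s + suc t
    head≡ = trans (cong suc x≡s+t) (sym (+-suc s t))
    step₁ : ∀ s t S → 2 * ((s + t) + S) + suc t ≡ (2 * S + t) + (2 * s + 2 * t + 1)
    step₁ = solve-∀
    step₂ : ∀ s t → t * (2 * s + t) + (2 * s + 2 * t + 1) ≡ suc t * (2 * s + suc t)
    step₂ = solve-∀
    sum≡ : 2 * (x + sum (y ∷ xs)) + suc t ≡ suc t * (2 * s + suc t)
    sum≡ = begin
      2 * (x + sum (y ∷ xs)) + suc t           ≡⟨ cong (λ z → 2 * (z + sum (y ∷ xs)) + suc t) x≡s+t ⟩
      2 * ((s + t) + sum (y ∷ xs)) + suc t     ≡⟨ step₁ s t (sum (y ∷ xs)) ⟩
      (2 * sum (y ∷ xs) + t) + (2 * s + 2 * t + 1) ≡⟨ cong (_+ (2 * s + 2 * t + 1)) (proj₂ ih) ⟩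
      t * (2 * s + t) + (2 * s + 2 * t + 1)    ≡⟨ step₂ s t ⟩
      suc t * (2 * s + suc t)                  ∎
  consecutive-sum x (y ∷ xs) () | no _

  strictFromGaps : List ℕ → List ℕ
  strictFromGaps []       = []
  strictFromGaps (w ∷ ws) = (suc (length ws) + w + sum ws) ∷ strictFromGaps ws

  strictGaps : List ℕ → List ℕ
  strictGaps []           = []
  strictGaps (x ∷ [])     = (x ∸ 1) ∷ []
  strictGaps (x ∷ y ∷ xs) = (x ∸ y ∸ 1) ∷ strictGaps (y ∷ xs)

  length-strictGaps : ∀ xs → length (strictGaps xs) ≡ length xs
  length-strictGaps []           = refl
  length-strictGaps (x ∷ [])     = refl
  length-strictGaps (x ∷ y ∷ xs) = cong suc (length-strictGaps (y ∷ xs))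

  strict-strictFromGaps : ∀ ws → Strict (strictFromGaps ws)
  strict-strictFromGaps ws = decreasing ws , positive ws
    where
    rearrange : ∀ l w v s → suc (suc l) + w + (v + s) ≡ suc (suc l + v + s) + w
    rearrange = solve-∀
    decreasing : ∀ ws → Linked _>_ (strictFromGaps ws)
    decreasing []           = []
    decreasing (w ∷ [])     = [-]
    decreasing (w ∷ v ∷ ws) =
      subst (suc (suc (length ws) + v + sum ws) ≤_) (sym (rearrange (length ws) w v (sum ws))) (m≤m+n _ w)
      ∷ decreasing (v ∷ ws)
    positive : ∀ ws → All (1 ≤_) (strictFromGaps ws)
    positive []       = []
    positive (w ∷ ws) = s≤s z≤n ∷ positive ws

  strictGaps-strictFromGaps : ∀ ws → strictGaps (strictFromGaps ws) ≡ ws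
  strictGaps-strictFromGaps []           = refl
  strictGaps-strictFromGaps (w ∷ [])     = cong (_∷ []) (+-identityʳ w)
  strictGaps-strictFromGaps (w ∷ v ∷ ws) = cong₂ _∷_ (cong (_∸ 1) head-gap) (strictGaps-strictFromGaps (v ∷ ws))
    where
    rest = suc (length ws) + v + sum ws
    rearrange : ∀ l w v s → suc (suc l) + w + (v + s) ≡ suc w + (suc l + v + s)
    rearrange = solve-∀
    head-gap : suc (suc (length ws)) + w + (v + sum ws) ∸ rest ≡ suc w
    head-gap = trans (cong (_∸ rest) (rearrange (length ws) w v (sum ws))) (m+n∸n≡m (suc w) rest)

  head-strictGaps : ∀ x xs → Strict (x ∷ xs) → suc (length xs) + sum (strictGaps (x ∷ xs)) ≡ x
  head-strictGaps (suc x) []       _                    = cong suc (+-identityʳ x)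
  head-strictGaps x       (y ∷ xs) (y<x ∷ decreasing , _ ∷ pos) with m≤n⇒∃[o]m+o≡n y<x
  ... | d , refl = begin
    suc l + ((suc y + d) ∸ y ∸ 1 + S) ≡⟨ cong (λ g → suc l + (g + S)) (gap-d y d) ⟩
    suc l + (d + S)                    ≡⟨ rearrange l S d ⟩
    suc ((l + S) + d)                  ≡⟨ cong (λ z → suc (z + d)) (head-strictGaps y xs (decreasing , pos)) ⟩
    suc y + d                          ∎
    where
    l = suc (length xs)
    S = sum (strictGaps (y ∷ xs))
    gap-d : ∀ y d → suc y + d ∸ y ∸ 1 ≡ d
    gap-d y d = cong (_∸ 1) (trans (cong (_∸ y) (sym (+-suc y d))) (m+n∸m≡n y (suc d)))
    rearrange : ∀ l S d → suc l + (d + S) ≡ suc ((l + S) + d)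
    rearrange = solve-∀
  head-strictGaps zero    []       (_ , () ∷ _)

  strictFromGaps-strictGaps : ∀ δ → Strict δ → strictFromGaps (strictGaps δ) ≡ δ
  strictFromGaps-strictGaps []           _                     = refl
  strictFromGaps-strictGaps (x ∷ [])     sδ                    = cong (_∷ []) (head-strictGaps x [] sδ)
  strictFromGaps-strictGaps (x ∷ y ∷ xs) sδ@(_ ∷ l , _ ∷ pos) = cong₂ _∷_ head (strictFromGaps-strictGaps (y ∷ xs) (l , pos))
    where
    head : suc (length (strictGaps (y ∷ xs))) + (x ∸ y ∸ 1) + sum (strictGaps (y ∷ xs)) ≡ x
    head = begin
      suc (length (strictGaps (y ∷ xs))) + (x ∸ y ∸ 1) + sum (strictGaps (y ∷ xs))
        ≡⟨ cong (λ m → suc m + (x ∸ y ∸ 1) + sum (strictGaps (y ∷ xs))) (length-strictGaps (y ∷ xs)) ⟩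
      suc (length (y ∷ xs)) + (x ∸ y ∸ 1) + sum (strictGaps (y ∷ xs))
        ≡⟨ +-assoc (suc (length (y ∷ xs))) (x ∸ y ∸ 1) _ ⟩
      suc (length (y ∷ xs)) + sum (strictGaps (x ∷ y ∷ xs))
        ≡⟨ head-strictGaps x (y ∷ xs) sδ ⟩
      x ∎

  sum-decode-diagonal : ∀ ws → sum (decode (ws , ws)) ≡ 2 * sum (strictFromGaps ws)
  sum-decode-diagonal ws = trans (sum-decode ws ws) (trans (double (length ws * suc (length ws)) (weight ws)) (sym (twice-sum ws)))
    where
    double : ∀ a w → a + w + w ≡ a + 2 * w
    double = solve-∀
    twice-sum : ∀ ws → 2 * sum (strictFromGaps ws) ≡ length ws * suc (length ws) + 2 * weight ws
    twice-sum []       = refl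
    twice-sum (w ∷ ws) = begin
      2 * (h + sum (strictFromGaps ws))                           ≡⟨ *-distribˡ-+ 2 h _ ⟩
      2 * h + 2 * sum (strictFromGaps ws)                         ≡⟨ cong (2 * h +_) (twice-sum ws) ⟩
      2 * h + (length ws * suc (length ws) + 2 * weight ws)       ≡⟨ rearrange (length ws) w (sum ws) (weight ws) ⟩
      suc (length ws) * suc (suc (length ws)) + 2 * (w + sum ws + weight ws) ∎
      where
      h = suc (length ws) + w + sum ws
      rearrange : ∀ l w s v → 2 * (suc l + w + s) + (l * suc l + 2 * v) ≡ suc l * suc (suc l) + 2 * (w + s + v)
      rearrange = solve-∀

  -- The involution on codes

  franklinGaps : List ℕ → List ℕ
  franklinGaps ws = strictGaps (franklin (strictFromGaps ws))

  strictFromGaps-franklinGaps : ∀ ws → strictFromGaps (franklinGaps ws) ≡ franklin (strictFromGaps ws)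
  strictFromGaps-franklinGaps ws =
    strictFromGaps-strictGaps (franklin (strictFromGaps ws)) (franklin-strict _ (strict-strictFromGaps ws))

  franklinGaps-involutive : ∀ ws → franklinGaps (franklinGaps ws) ≡ ws
  franklinGaps-involutive ws = begin
    strictGaps (franklin (strictFromGaps (franklinGaps ws))) ≡⟨ cong (λ δ → strictGaps (franklin δ)) (strictFromGaps-franklinGaps ws) ⟩
    strictGaps (franklin (franklin (strictFromGaps ws)))    ≡⟨ cong strictGaps (franklin-involutive _ (strict-strictFromGaps ws)) ⟩
    strictGaps (strictFromGaps ws)                           ≡⟨ strictGaps-strictFromGaps ws ⟩
    ws                                                       ∎

  pairInvolution : List ℕ × List ℕ → List ℕ × List ℕ
  pairInvolution (u , v) with ≡-dec _≟_ u v
  ... | yes _ = franklinGaps u , franklinGaps u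
  ... | no  _ = v , u

  pairInvolution-valid : ∀ {n} c → ValidCode n c → ValidCode n (pairInvolution c)
  pairInvolution-valid {n} (u , v) (l≡ , sum≡) with ≡-dec _≟_ u v
  ... | yes refl = refl , (begin
    sum (decode (franklinGaps u , franklinGaps u))  ≡⟨ sum-decode-diagonal (franklinGaps u) ⟩
    2 * sum (strictFromGaps (franklinGaps u))        ≡⟨ cong (λ δ → 2 * sum δ) (strictFromGaps-franklinGaps u) ⟩
    2 * sum (franklin (strictFromGaps u))            ≡⟨ cong (2 *_) (franklin-sum _ (strict-strictFromGaps u)) ⟩
    2 * sum (strictFromGaps u)                       ≡⟨ sym (sum-decode-diagonal u) ⟩
    sum (decode (u , u))                             ≡⟨ sum≡ ⟩
    n                                                ∎)
  ... | no _ = sym l≡ , (begin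
    sum (decode (v , u))                                   ≡⟨ sum-decode v u ⟩
    length v * suc (length v) + weight v + weight u        ≡⟨ cong (λ l → l * suc l + weight v + weight u) l≡ ⟩
    length u * suc (length u) + weight v + weight u        ≡⟨ +-swapʳ (length u * suc (length u)) (weight v) (weight u) ⟩
    length u * suc (length u) + weight u + weight v        ≡⟨ sym (sum-decode u v) ⟩
    sum (decode (u , v))                                   ≡⟨ sum≡ ⟩
    n                                                      ∎)
    where
    +-swapʳ : ∀ a b c → a + b + c ≡ a + c + b
    +-swapʳ = solve-∀

  pairInvolution-involutive : ∀ c → pairInvolution (pairInvolution c) ≡ c
  pairInvolution-involutive (u , v) with ≡-dec _≟_ u v
  pairInvolution-involutive (u , .u) | yes refl with ≡-dec _≟_ (franklinGaps u) (franklinGaps u)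
  ... | yes _  = cong (λ w → w , w) (franklinGaps-involutive u)
  ... | no ≢  = contradiction refl ≢
  pairInvolution-involutive (u , v)  | no u≢v with ≡-dec _≟_ v u
  ... | yes v≡u = contradiction (sym v≡u) u≢v
  ... | no _    = refl

  TwicePentagonal : ℕ → Set
  TwicePentagonal n = ∃ λ (j : ℤ) → ℤ.+ n ≡ j ℤ.* (ℤ.+ 3 ℤ.* j ℤ.- ℤ.+ 1)

  twice-run-sum : ∀ S t s → 2 * S + t ≡ t * (2 * s + t) → ℤ.+ (2 * S) ≡ ℤ.+ t ℤ.* (ℤ.+ 2 ℤ.* ℤ.+ s ℤ.+ ℤ.+ t ℤ.- ℤ.+ 1)
  twice-run-sum S t s h = begin
    ℤ.+ (2 * S)                                 ≡⟨ add-sub (ℤ.+ (2 * S)) (ℤ.+ t) ⟩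
    ℤ.+ (2 * S + t) ℤ.- ℤ.+ t                   ≡⟨ cong (λ a → ℤ.+ a ℤ.- ℤ.+ t) h ⟩
    ℤ.+ (t * (2 * s + t)) ℤ.- ℤ.+ t             ≡⟨ cong (ℤ._- ℤ.+ t) (ℤP.pos-* t (2 * s + t)) ⟩
    ℤ.+ t ℤ.* (ℤ.+ (2 * s) ℤ.+ ℤ.+ t) ℤ.- ℤ.+ t ≡⟨ cong (λ a → ℤ.+ t ℤ.* (a ℤ.+ ℤ.+ t) ℤ.- ℤ.+ t) (ℤP.pos-* 2 s) ⟩
    ℤ.+ t ℤ.* (ℤ.+ 2 ℤ.* ℤ.+ s ℤ.+ ℤ.+ t) ℤ.- ℤ.+ t ≡⟨ factor (ℤ.+ t) (ℤ.+ s) ⟩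
    ℤ.+ t ℤ.* (ℤ.+ 2 ℤ.* ℤ.+ s ℤ.+ ℤ.+ t ℤ.- ℤ.+ 1) ∎
    where
    add-sub : ∀ a b → a ≡ a ℤ.+ b ℤ.- b
    add-sub = ZR.solve-∀
    factor : ∀ t s → t ℤ.* (ℤ.+ 2 ℤ.* s ℤ.+ t) ℤ.- t ≡ t ℤ.* (ℤ.+ 2 ℤ.* s ℤ.+ t ℤ.- ℤ.+ 1)
    factor = ZR.solve-∀

  -- The two fixed shapes of Franklin's involution: a run of t parts ending in t, or in t + 1.
  run-pentagonal : ∀ S t s → 2 * S + t ≡ t * (2 * s + t) → s ≡ t ⊎ s ≡ suc t → TwicePentagonal (2 * S)
  run-pentagonal S t .t       h (inj₁ refl) = ℤ.+ t , trans (twice-run-sum S t t h) (ending-in-t (ℤ.+ t))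
    where
    ending-in-t : ∀ t → t ℤ.* (ℤ.+ 2 ℤ.* t ℤ.+ t ℤ.- ℤ.+ 1) ≡ t ℤ.* (ℤ.+ 3 ℤ.* t ℤ.- ℤ.+ 1)
    ending-in-t = ZR.solve-∀
  run-pentagonal S t .(suc t) h (inj₂ refl) = ℤ.- ℤ.+ t , trans (twice-run-sum S t (suc t) h) (ending-in-t+1 (ℤ.+ t))
    where
    ending-in-t+1 : ∀ t → t ℤ.* (ℤ.+ 2 ℤ.* (ℤ.+ 1 ℤ.+ t) ℤ.+ t ℤ.- ℤ.+ 1) ≡ ℤ.- t ℤ.* (ℤ.+ 3 ℤ.* ℤ.- t ℤ.- ℤ.+ 1)
    ending-in-t+1 = ZR.solve-∀

  franklin-fixed-pentagonal : ∀ δ → Strict δ → franklin δ ≡ δ → TwicePentagonal (2 * sum δ)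
  franklin-fixed-pentagonal []       _  _     = ℤ.+ 0 , refl
  franklin-fixed-pentagonal (x ∷ xs) sδ fixed with franklin-fixed (x ∷ xs) sδ fixed
  ... | ¬spread , ¬gather with franklin-fixed-shape (x ∷ xs) ¬spread ¬gather
  ... | slope≡t , smallest≡ =
    run-pentagonal (sum (x ∷ xs)) (suc (length xs)) (smallest (x ∷ xs)) (proj₂ (consecutive-sum x xs slope≡t)) smallest≡

  pairInvolution-fixed : ∀ {n} c → ValidCode n c → pairInvolution c ≡ c → TwicePentagonal n
  pairInvolution-fixed (u , v) (_ , sum≡) fixed with ≡-dec _≟_ u v
  ... | no u≢v   = contradiction (sym (cong proj₁ fixed)) u≢v
  ... | yes refl = subst TwicePentagonal (trans (sym (sum-decode-diagonal u)) sum≡)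
                         (franklin-fixed-pentagonal δ (strict-strictFromGaps u) franklin-fixes-δ)
    where
    δ = strictFromGaps u
    franklin-fixes-δ : franklin δ ≡ δ
    franklin-fixes-δ = trans (sym (strictFromGaps-franklinGaps u)) (cong strictFromGaps (cong proj₁ fixed))

  crankInvolution : List ℕ → List ℕ
  crankInvolution xs = decode (pairInvolution (encode xs))

  module _ {n xs} (p : NonnegCrankPartition n xs) where

    private
      code : List ℕ × List ℕ
      code = pairInvolution (encode xs)

      code-valid : ValidCode n code
      code-valid = pairInvolution-valid (encode xs) (encode-valid p)

      encode-crankInvolution : encode (crankInvolution xs) ≡ code
      encode-crankInvolution = encode-decode (proj₁ code) (proj₂ code) (proj₁ code-valid)

    crankInvolution-closed : NonnegCrankPartition n (crankInvolution xs)
    crankInvolution-closed = decode-valid (proj₁ code) (proj₂ code) code-valid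

    crankInvolution-involutive : crankInvolution (crankInvolution xs) ≡ xs
    crankInvolution-involutive = begin
      decode (pairInvolution (encode (crankInvolution xs)))  ≡⟨ cong (λ c → decode (pairInvolution c)) encode-crankInvolution ⟩
      decode (pairInvolution code)                           ≡⟨ cong decode (pairInvolution-involutive (encode xs)) ⟩
      decode (encode xs)                                     ≡⟨ decode-encode p ⟩
      xs                                                     ∎

    crankInvolution-fixed : crankInvolution xs ≡ xs → TwicePentagonal n
    crankInvolution-fixed fixed =
      pairInvolution-fixed (encode xs) (encode-valid p) (trans (sym encode-crankInvolution) (cong encode fixed))


open import Defs
open import Data.Nat using (ℕ)
open import Data.Nat.Divisibility using (_∣_)
open import Data.Integer using (ℤ; +_; _*_; _-_; _≤_)
open import Data.List using (List; length)
open import Data.List.Membership.Propositional using (_∈_)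
open import Data.List.Relation.Unary.Unique.Propositional using (Unique)
open import Data.Product using (∃; _×_)
open import Function.Bundles using (_⇔_; module Equivalence)
open import Relation.Nullary using (¬_)
open import Relation.Binary.PropositionalEquality using (_≡_)

open FixedPointFreeInvolution using (even-length)
open CrankInvolution using (crankInvolution; crankInvolution-closed; crankInvolution-involutive; crankInvolution-fixed)

corollary7 : (n : ℕ) → (L : List (List ℕ)) → Unique L →
    (∀ λs → (λs ∈ L) ⇔ (IsPartition n λs × (+ 0 ≤ crank λs))) →
    ¬ (∃ λ (j : ℤ) → + n ≡ j * (+ 3 * j - + 1)) →
    2 ∣ length L
corollary7 n L unique members notPentagonal = even-length L unique record
  { closed           = λ {λs} m → from (members (crankInvolution λs)) (crankInvolution-closed (to (members λs) m))
  ; involutive       = λ {λs} m → crankInvolution-involutive (to (members λs) m)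
  ; fixed-point-free = λ {λs} m fixed → notPentagonal (crankInvolution-fixed (to (members λs) m) fixed)
  }
  where open Equivalence
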